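{- Let $M$ be a rooted cubic planar map with $2n$ vertices and let $T=M^*$ be its dual triangulation, with root vertex $r$. Then there is a bijection between the set of perfect matchings of $M$ and the set of (not necessarily proper) vertex $2$-colourings $c\colon V(T)\to\{1,2\}$ with $c(r)=1$ having exactly $n$ monochromatic edges.
   Context: A map is a connected planar multigraph (loops and multiple edges allowed) together with a fixed embedding in the plane (sphere); it is rooted if one edge is distinguished and given a direction. A map is cubic if every vertex has degree 3 (a loop contributes 2 to the degree). The dual $M^*$ has a vertex for each face of $M$ and, for each edge $e$ of $M$, an edge $e^*$ joining the two faces incident with $e$ (a loop if these coincide); the dual of a cubic map is a triangulation (every face has degree 3), possibly with loops and multiple edges, and it inherits a root (a directed root edge), whose tail is called the root vertex $r$. An edge of $T$ is monochromatic under $c$ if its two endpoints receive the same colour (loops are monochromatic). A perfect matching is a set of edges with no common endpoints covering all vertices. -}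

module Defs where

open import Data.Nat using (ℕ; zero; suc; _+_; _*_; _≤ᵇ_; _<ᵇ_)
open import Data.Fin using (Fin; toℕ)
open import Data.Bool using (Bool; true; false; _∧_; if_then_else_)
open import Data.List using (List; []; _∷_; length; upTo; allFin)
open import Data.Product using (Σ; _,_; proj₁)
open import Relation.Binary.PropositionalEquality using (_≡_; _≢_; refl; sym; trans)
open import Relation.Binary.Bundles using (Setoid)
open import Level using (0ℓ)

-- Combinatorial maps (rotation systems) on a finite set of darts Fin k.
--   α : edge involution (fixed-point free), edges = α-orbits
--   σ : vertex rotation, vertices = σ-orbits
--   φ = σ ∘ α : face permutation, faces = φ-orbits

all : {A : Set} → (A → Bool) → List A → Bool
all p []       = true
all p (x ∷ xs) = p x ∧ all p xs

countᵇ : {A : Set} → (A → Bool) → List A → ℕ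
countᵇ p []       = 0
countᵇ p (x ∷ xs) = if p x then suc (countᵇ p xs) else countᵇ p xs

iter : {A : Set} → (A → A) → ℕ → A → A
iter f zero    x = x
iter f (suc j) x = f (iter f j x)

isOrbitMin : {k : ℕ} → (Fin k → Fin k) → Fin k → Bool
isOrbitMin {k} f d = all (λ j → toℕ d ≤ᵇ toℕ (iter f j d)) (upTo k)

numOrbits : {k : ℕ} → (Fin k → Fin k) → ℕ
numOrbits {k} f = countᵇ (isOrbitMin f) (allFin k)

data Reach {k : ℕ} (σ α : Fin k → Fin k) : Fin k → Fin k → Set where
  here  : ∀ {d} → Reach σ α d d
  stepσ : ∀ {d e} → Reach σ α d e → Reach σ α d (σ e)
  stepα : ∀ {d e} → Reach σ α d e → Reach σ α d (α e)

record RootedCubicPlanarMap (k : ℕ) : Set where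
  field
    α σ       : Fin k → Fin k
    α-invol   : ∀ d → α (α d) ≡ d
    α-nofix   : ∀ d → α d ≢ d
    σ-cube    : ∀ d → σ (σ (σ d)) ≡ d
    σ-nofix   : ∀ d → σ d ≢ d
    connected : ∀ d e → Reach σ α d e
    root      : Fin k
    -- planar (genus 0): Euler's formula V - E + F = 2, where
    -- V = #σ-orbits, E = #α-orbits, F = #(σ∘α)-orbits
    euler     : numOrbits σ + numOrbits (λ d → σ (α d)) ≡ numOrbits α + 2

open RootedCubicPlanarMap public

module _ {k : ℕ} (M : RootedCubicPlanarMap k) where
  φ : Fin k → Fin k
  φ d = σ M (α M d)
  numVertices numEdges numFaces : ℕ
  numVertices = numOrbits (σ M)
  numEdges    = numOrbits (α M)
  numFaces    = numOrbits φ

boolEq : Bool → Bool → Bool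
boolEq true  true  = true
boolEq false false = true
boolEq _     _     = false

-- A set of edges of M, as an α-invariant predicate on darts, is a perfect
-- matching iff around each vertex (d, σ d, σ σ d) exactly one dart lies on
-- a chosen edge (this excludes loops and two chosen edges at a vertex).
IsPerfectMatching : {k : ℕ} → RootedCubicPlanarMap k → (Fin k → Bool) → Set
IsPerfectMatching M m =
  (∀ d → m (α M d) ≡ m d) ×' (∀ d → countᵇ m (d ∷ σ M d ∷ σ M (σ M d) ∷ []) ≡ 1)
  where open import Data.Product renaming (_×_ to _×'_)

data Colour : Set where
  c1 c2 : Colour

sameColour : Colour → Colour → Bool
sameColour c1 c1 = true
sameColour c2 c2 = true
sameColour _  _  = false

-- A vertex colouring of T = M* is a colouring of the faces of M, i.e. a
-- φ-invariant colouring of the darts.  Dual edge e* of the edge {d, α d}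
-- joins the faces of d and α d; it is monochromatic iff c d = c (α d).
numMonoEdges : {k : ℕ} → RootedCubicPlanarMap k → (Fin k → Colour) → ℕ
numMonoEdges {k} M c =
  countᵇ (λ d → isOrbitMin (α M) d ∧ sameColour (c d) (c (α M d))) (allFin k)

-- colourings c : V(T) → {1,2} with c(r) = 1 (r = face of M containing the
-- root dart) with exactly n monochromatic edges
IsGoodColouring : {k : ℕ} → RootedCubicPlanarMap k → ℕ → (Fin k → Colour) → Set
IsGoodColouring M n c =
  (∀ d → c (φ M d) ≡ c d) ×' ((c (root M) ≡ c1) ×' (numMonoEdges M c ≡ n))
  where open import Data.Product renaming (_×_ to _×'_)

SubFunSetoid : (k : ℕ) (B : Set) → ((Fin k → B) → Set) → Setoid 0ℓ 0ℓ
SubFunSetoid k B P = record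
  { Carrier = Σ (Fin k → B) P
  ; _≈_ = λ x y → ∀ d → proj₁ x d ≡ proj₁ y d
  ; isEquivalence = record
    { refl = λ d → refl
    ; sym = λ p d → sym (p d)
    ; trans = λ p q d → trans (p d) (q d) } }

PerfectMatchings : {k : ℕ} → RootedCubicPlanarMap k → Setoid 0ℓ 0ℓ
PerfectMatchings {k} M = SubFunSetoid k Bool (IsPerfectMatching M)

GoodColourings : {k : ℕ} → RootedCubicPlanarMap k → ℕ → Setoid 0ℓ 0ℓ
GoodColourings {k} M n = SubFunSetoid k Colour (IsGoodColouring M n)

-- A perfect matching m corresponds to the face colouring of M whose monochromatic edges are
-- exactly the matched ones; since M is connected, a colouring is determined by its value at
-- the root face and its set of monochromatic edges.
--
-- From a colouring with n monochromatic edges: every vertex of M corresponds to a triangle of T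
-- and so meets at least one monochromatic edge, while the n monochromatic edges have only
-- 2n = V ends.  Hence every vertex meets exactly one, and they form a perfect matching.
--
-- From a matching: around every vertex exactly two darts are unmatched, so the unmatched edges
-- form a 1-cocycle mod 2, and on the sphere it is the coboundary of a face colouring.
-- Concretely, take the double cover of M whose sheets are exchanged across unmatched edges.  It
-- is again a cubic map and each face of M lifts to two faces, so a connected cover would have
-- V′ + F′ − E′ = 2 (V + F − E) = 4, contradicting the Euler inequality V + F ≤ E + 2 for
-- connected maps.  The cover is therefore disconnected, and the sheet reached from the root is
-- the colouring.

module Submission where

open import Defs
open import Data.Nat using (>-nonZero; ℕ; zero; suc; _+_; _*_; _∸_; _≤_; _<_; _≤ᵇ_; _<ᵇ_; _%_; _/_; _⊓_; z≤n; s≤s; NonZero; _≤?_; _<?_)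
open import Data.Nat.Properties
open import Data.Nat.Tactic.RingSolver using (solve-∀)
open import Data.Nat.DivMod using (m≡m%n+[m/n]*n; m%n<n)
open import Data.Fin as Fin using (Fin; toℕ; zero; suc; fromℕ<; _↑ˡ_; _↑ʳ_; splitAt)
import Data.Fin.Properties as Finₚ
open import Data.Fin.Properties using (toℕ-injective; toℕ<n; toℕ-fromℕ<; toℕ≤pred[n]; pigeonhole; any?; toℕ-↑ˡ; toℕ-↑ʳ; splitAt-↑ˡ; splitAt-↑ʳ; join-splitAt)
open import Data.Bool using (Bool; true; false; _∧_; not; if_then_else_; _xor_)
open import Data.Bool.Properties using (⇔→≡; xor-same; xor-assoc; not-distribʳ-xor; not-involutive; ∧-zeroʳ; ∧-identityʳ; ¬-not)
import Data.Bool.Properties as Bool using (_≟_)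
open import Data.List using ([]; _∷_; tabulate; allFin; upTo; applyUpTo)
open import Data.Product using (Σ; _,_; proj₁; proj₂; ∃; _×_)
open import Data.Sum using (_⊎_; inj₁; inj₂)
open import Data.Empty using (⊥; ⊥-elim)
open import Relation.Binary using (tri<; tri≈; tri>)
open import Relation.Nullary using (¬_; Dec; yes; no; does; ¬?)
open import Relation.Nullary.Decidable using (dec-true; dec-false; _×-dec_; decidable-stable)
open import Relation.Binary.PropositionalEquality
open import Function using (_∘_)
open import Function.Bundles using (Bijection; mk⇔)
open import Data.Fin.Permutation using (permutation)
open import Data.Fin.Permutation.Components using (transpose)
open import Algebra.Properties.CommutativeMonoid.Sum +-0-commutativeMonoid using (sum; sum-cong-≗; ∑-distrib-+; sum-permute)

does-true : ∀ {A : Set} (a? : Dec A) → does a? ≡ true → A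
does-true (yes a) _ = a

does-false : ∀ {A : Set} (a? : Dec A) → does a? ≡ false → ¬ A
does-false a? eq a with () ← trans (sym eq) (dec-true a? a)

≤ᵇ≡true⇒≤ : ∀ {m n} → (m ≤ᵇ n) ≡ true → m ≤ n
≤ᵇ≡true⇒≤ {m} {n} = does-true (m ≤? n)

≤ᵇ≡false⇒≥ : ∀ {m n} → (m ≤ᵇ n) ≡ false → n ≤ m
≤ᵇ≡false⇒≥ {m} {n} = ≰⇒≥ ∘ does-false (m ≤? n)

indicator : Bool → ℕ
indicator true  = 1
indicator false = 0

countᵇ-tabulate : ∀ {A : Set} {n} (P : A → Bool) (f : Fin n → A) →
  countᵇ P (tabulate f) ≡ sum (indicator ∘ P ∘ f)
countᵇ-tabulate {n = zero}  P f = refl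
countᵇ-tabulate {n = suc n} P f with P (f zero)
... | true  = cong suc (countᵇ-tabulate P (f ∘ suc))
... | false = countᵇ-tabulate P (f ∘ suc)

countᵇ-allFin : ∀ {n} (P : Fin n → Bool) → countᵇ P (allFin n) ≡ sum (indicator ∘ P)
countᵇ-allFin P = countᵇ-tabulate P (λ i → i)

countᵇ-cong : ∀ {A : Set} {P Q : A → Bool} → (∀ x → P x ≡ Q x) → ∀ xs → countᵇ P xs ≡ countᵇ Q xs
countᵇ-cong P≗Q []       = refl
countᵇ-cong {Q = Q} P≗Q (x ∷ xs) rewrite P≗Q x with Q x
... | true  = cong suc (countᵇ-cong P≗Q xs)
... | false = countᵇ-cong P≗Q xs

countᵇ-triple : ∀ {A : Set} (P : A → Bool) x y z →
  countᵇ P (x ∷ y ∷ z ∷ []) ≡ indicator (P x) + indicator (P y) + indicator (P z)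
countᵇ-triple P x y z with P x | P y | P z
... | true  | true  | true  = refl
... | true  | true  | false = refl
... | true  | false | true  = refl
... | true  | false | false = refl
... | false | true  | true  = refl
... | false | true  | false = refl
... | false | false | true  = refl
... | false | false | false = refl

all-cong : ∀ {A : Set} {P Q : A → Bool} → (∀ x → P x ≡ Q x) → ∀ xs → all P xs ≡ all Q xs
all-cong P≗Q []       = refl
all-cong P≗Q (x ∷ xs) = cong₂ _∧_ (P≗Q x) (all-cong P≗Q xs)

all-applyUpTo⁻ : (P : ℕ → Bool) (g : ℕ → ℕ) (n : ℕ) → all P (applyUpTo g n) ≡ true →
  ∀ j → j < n → P (g j) ≡ true
all-applyUpTo⁻ P g (suc n) h j j<1+n with P (g 0) in P0
all-applyUpTo⁻ P g (suc n) h zero    _         | true = P0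
all-applyUpTo⁻ P g (suc n) h (suc j) (s≤s j<n) | true = all-applyUpTo⁻ P (g ∘ suc) n h j j<n

all-applyUpTo⁺ : (P : ℕ → Bool) (g : ℕ → ℕ) (n : ℕ) → (∀ j → j < n → P (g j) ≡ true) →
  all P (applyUpTo g n) ≡ true
all-applyUpTo⁺ P g zero    h = refl
all-applyUpTo⁺ P g (suc n) h rewrite h 0 (s≤s z≤n) =
  all-applyUpTo⁺ P (g ∘ suc) n (λ j j<n → h (suc j) (s≤s j<n))

sum-ones : ∀ n → sum (λ (_ : Fin n) → 1) ≡ n
sum-ones zero    = refl
sum-ones (suc n) = cong suc (sum-ones n)

sum-of-false : ∀ {n} (P : Fin n → Bool) → (∀ i → P i ≡ false) → sum (indicator ∘ P) ≡ 0
sum-of-false {zero}  P h = refl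
sum-of-false {suc n} P h rewrite h zero = sum-of-false (P ∘ suc) (h ∘ suc)

sum-of-unique : ∀ {n} (P : Fin n → Bool) (w : Fin n) → P w ≡ true →
  (∀ i → P i ≡ true → i ≡ w) → sum (indicator ∘ P) ≡ 1
sum-of-unique P zero Pw unique rewrite Pw = cong suc (sum-of-false (P ∘ suc) P∘suc≡false)
  where
  P∘suc≡false : ∀ i → P (suc i) ≡ false
  P∘suc≡false i with P (suc i) in eq
  ... | true with () ← unique (suc i) eq
  ... | false = refl
sum-of-unique P (suc w) Pw unique with P zero in eq
... | true with () ← unique zero eq
... | false = sum-of-unique (P ∘ suc) w Pw (λ i Pi → Finₚ.suc-injective (unique (suc i) Pi))

n≤sum : ∀ {n} (t : Fin n → ℕ) → (∀ i → 1 ≤ t i) → n ≤ sum t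
n≤sum {zero}  t h = z≤n
n≤sum {suc n} t h = +-mono-≤ (h zero) (n≤sum (t ∘ suc) (h ∘ suc))

sum≡n⇒all≡1 : ∀ {n} (t : Fin n → ℕ) → (∀ i → 1 ≤ t i) → sum t ≡ n → ∀ i → t i ≡ 1
sum≡n⇒all≡1 {suc n} t h sum≡ = each
  where
  t0≡1 : t zero ≡ 1
  t0≡1 = ≤-antisym (+-cancelʳ-≤ (sum (t ∘ suc)) (t zero) 1
           (≤-trans (≤-reflexive sum≡) (s≤s (n≤sum (t ∘ suc) (h ∘ suc))))) (h zero)
  each : ∀ i → t i ≡ 1
  each zero    = t0≡1
  each (suc i) = sum≡n⇒all≡1 (t ∘ suc) (h ∘ suc)
    (suc-injective (trans (cong (_+ sum (t ∘ suc)) (sym t0≡1)) sum≡)) i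

sum-indicator-at : ∀ {n} (x : Fin n) (P : Fin n → Bool) →
  sum (λ d → indicator (does (d Fin.≟ x) ∧ P d)) ≡ indicator (P x)
sum-indicator-at x P with P x in Px
... | true  = sum-of-unique _ x (trans (cong (_∧ P x) (dec-true (x Fin.≟ x) refl)) Px) unique
  where
  unique : ∀ d → (does (d Fin.≟ x) ∧ P d) ≡ true → d ≡ x
  unique d h with d Fin.≟ x
  ... | yes d≡x = d≡x
... | false = sum-of-false _ only-x
  where
  only-x : ∀ d → (does (d Fin.≟ x) ∧ P d) ≡ false
  only-x d with d Fin.≟ x
  ... | yes refl = Px
  ... | no _     = refl

sum-split : ∀ m n (g : Fin (m + n) → ℕ) → sum g ≡ sum (λ i → g (i ↑ˡ n)) + sum (λ i → g (m ↑ʳ i))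
sum-split zero    n g = refl
sum-split (suc m) n g =
  trans (cong (g zero +_) (sum-split m n (g ∘ suc))) (sym (+-assoc (g zero) _ _))

<ᵇ-suc : ∀ {m j} → m ≢ j → (m <ᵇ suc j) ≡ (m <ᵇ j)
<ᵇ-suc {m} {j} m≢j with <-cmp m j
... | tri< m<j _ _ = trans (dec-true (m <? suc j) (m<n⇒m<1+n m<j)) (sym (dec-true (m <? j) m<j))
... | tri≈ _ m≡j _ = ⊥-elim (m≢j m≡j)
... | tri> _ _ j<m = trans (dec-false (m <? suc j) (λ m<1+j → <⇒≱ j<m (≤-pred m<1+j)))
                           (sym (dec-false (m <? j) (<⇒≯ j<m)))

iter-+ : ∀ {A : Set} (f : A → A) i j x → iter f (i + j) x ≡ iter f i (iter f j x)
iter-+ f zero    j x = refl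
iter-+ f (suc i) j x = cong f (iter-+ f i j x)

iter-cong : ∀ {A : Set} {f g : A → A} → (∀ x → f x ≡ g x) → ∀ j x → iter f j x ≡ iter g j x
iter-cong f≗g zero    x = refl
iter-cong {g = g} f≗g (suc j) x = trans (f≗g _) (cong g (iter-cong f≗g j x))

iter-* : ∀ {A : Set} (f : A → A) p x → iter f p x ≡ x → ∀ m → iter f (m * p) x ≡ x
iter-* f p x fix zero    = refl
iter-* f p x fix (suc m) =
  trans (iter-+ f p (m * p) x) (trans (cong (iter f p) (iter-* f p x fix m)) fix)

minimal-witness : (Q : ℕ → Set) → (∀ n → Dec (Q n)) → ∀ n → Q n →
  ∃ λ m → Q m × (∀ j → j < m → ¬ Q j)
minimal-witness Q Q? zero    Qn = zero , Qn , λ _ ()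
minimal-witness Q Q? (suc n) Qn with Q? zero | minimal-witness (Q ∘ suc) (Q? ∘ suc) n Qn
... | yes Q0 | _ = zero , Q0 , λ _ ()
... | no ¬Q0 | m , Qm , below = suc m , Qm , below′
  where
  below′ : ∀ j → j < suc m → ¬ Q j
  below′ zero    _         = ¬Q0
  below′ (suc j) (s≤s j<m) = below j j<m

minimal-Fin : ∀ {k} (P : Fin k → Bool) (w : Fin k) → P w ≡ true →
  ∃ λ m → P m ≡ true × (∀ e → P e ≡ true → toℕ m ≤ toℕ e)
minimal-Fin {suc k} P w Pw with P zero in P0
... | true = zero , P0 , λ _ _ → z≤n
minimal-Fin P zero    Pw | false with () ← trans (sym P0) Pw
minimal-Fin P (suc w) Pw | false with minimal-Fin (P ∘ suc) w Pw
... | m , Pm , m-min = suc m , Pm , suc-m-min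
  where
  suc-m-min : ∀ e → P e ≡ true → toℕ (suc m) ≤ toℕ e
  suc-m-min zero    Pe with () ← trans (sym P0) Pe
  suc-m-min (suc e) Pe = s≤s (m-min e Pe)

record IsPermutation {k : ℕ} (f : Fin k → Fin k) : Set where
  field
    inv      : Fin k → Fin k
    inverseʳ : ∀ x → f (inv x) ≡ x
    inverseˡ : ∀ x → inv (f x) ≡ x

open IsPermutation

IsPermutation-∘ : ∀ {k} {f g : Fin k → Fin k} → IsPermutation f → IsPermutation g →
  IsPermutation (f ∘ g)
IsPermutation-∘ {f = f} {g} P Q = record
  { inv      = inv Q ∘ inv P
  ; inverseʳ = λ x → trans (cong f (inverseʳ Q (inv P x))) (inverseʳ P x)
  ; inverseˡ = λ x → trans (cong (inv Q) (inverseˡ P (g x))) (inverseˡ Q x) }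

sum-∘IsPermutation : ∀ {k} {π : Fin k → Fin k} → IsPermutation π → (g : Fin k → ℕ) → sum (g ∘ π) ≡ sum g
sum-∘IsPermutation {π = π} P g = sym (sum-permute g (permutation π (inv P) (inverseʳ P) (inverseˡ P)))

involution⇒IsPermutation : ∀ {k} {f : Fin k → Fin k} → (∀ d → f (f d) ≡ d) → IsPermutation f
involution⇒IsPermutation {f = f} f∘f≗id = record { inv = f ; inverseʳ = f∘f≗id ; inverseˡ = f∘f≗id }

order3⇒IsPermutation : ∀ {k} {f : Fin k → Fin k} → (∀ d → f (f (f d)) ≡ d) → IsPermutation f
order3⇒IsPermutation {f = f} f³≗id = record { inv = f ∘ f ; inverseʳ = f³≗id ; inverseˡ = f³≗id }

module _ {k : ℕ} {f : Fin k → Fin k} (P : IsPermutation f) where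

  IsPermutation-injective : ∀ {x y} → f x ≡ f y → x ≡ y
  IsPermutation-injective {x} {y} fx≡fy =
    trans (sym (inverseˡ P x)) (trans (cong (inv P) fx≡fy) (inverseˡ P y))

  iter-cancelʳ : ∀ d i x → iter f (d + i) x ≡ iter f i x → iter f d x ≡ x
  iter-cancelʳ d zero    x eq = trans (cong (λ m → iter f m x) (sym (+-identityʳ d))) eq
  iter-cancelʳ d (suc i) x eq = iter-cancelʳ d i x
    (IsPermutation-injective (trans (cong (λ m → iter f m x) (sym (+-suc d i))) eq))

  iter-collision : ∀ {s t x} → s < t → iter f s x ≡ iter f t x → iter f (t ∸ s) x ≡ x
  iter-collision {s} {t} {x} s<t eq = iter-cancelʳ (t ∸ s) s x
    (trans (cong (λ m → iter f m x) (m∸n+n≡m (<⇒≤ s<t))) (sym eq))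

  has-period : ∀ x → ∃ λ p → 1 ≤ p × p ≤ k × iter f p x ≡ x
  has-period x with pigeonhole (n<1+n k) (λ (i : Fin (suc k)) → iter f (toℕ i) x)
  ... | i , j , i<j , eq =
    toℕ j ∸ toℕ i , m<n⇒0<n∸m i<j , ≤-trans (m∸n≤m (toℕ j) (toℕ i)) (toℕ≤pred[n] j) ,
    iter-collision i<j eq

record LeastPeriod {k : ℕ} (f : Fin k → Fin k) (x : Fin k) : Set where
  field
    period          : ℕ
    period-positive : 1 ≤ period
    period-returns  : iter f period x ≡ x
    period-minimal  : ∀ j → 1 ≤ j → j < period → iter f j x ≢ x

leastPeriod : ∀ {k} {f : Fin k → Fin k} → IsPermutation f → ∀ x → LeastPeriod f x
leastPeriod {f = f} P x with has-period P x
... | p , 1≤p , _ , fᵖx≡x with minimal-witness (λ j → 1 ≤ j × iter f j x ≡ x) returns? p (1≤p , fᵖx≡x)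
  where
  returns? : ∀ j → Dec (1 ≤ j × iter f j x ≡ x)
  returns? j = (1 ≤? j) ×-dec (iter f j x Fin.≟ x)
... | q , (1≤q , fᵠx≡x) , below =
  record { period = q ; period-positive = 1≤q ; period-returns = fᵠx≡x
         ; period-minimal = λ j 1≤j j<q fʲx≡x → below j j<q (1≤j , fʲx≡x) }

orbitMinimaIn : ∀ {k} → (Fin k → Bool) → (Fin k → Fin k) → ℕ
orbitMinimaIn S g = sum (λ d → indicator (S d ∧ isOrbitMin g d))

InOrbit : ∀ {k} (f : Fin k → Fin k) → Fin k → Fin k → Set
InOrbit f x y = ∃ λ j → iter f j x ≡ y

module _ {k : ℕ} {f : Fin k → Fin k} where

  InOrbit-refl : ∀ {x} → InOrbit f x x
  InOrbit-refl = 0 , refl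

  InOrbit-step : ∀ {x y} → InOrbit f x y → InOrbit f x (f y)
  InOrbit-step (j , eq) = suc j , cong f eq

  InOrbit-trans : ∀ {x y z} → InOrbit f x y → InOrbit f y z → InOrbit f x z
  InOrbit-trans {x} (i , eq) (j , eq′) =
    j + i , trans (iter-+ f j i x) (trans (cong (iter f j) eq) eq′)

  InOrbit-closed : (S : Fin k → Bool) → (∀ d → S d ≡ true → S (f d) ≡ true) →
    ∀ {d e} → S d ≡ true → InOrbit f d e → S e ≡ true
  InOrbit-closed S closed Sd (zero  , refl) = Sd
  InOrbit-closed S closed Sd (suc j , refl) = closed _ (InOrbit-closed S closed Sd (j , refl))

  module _ (P : IsPermutation f) where

    InOrbit-sym : ∀ {x y} → InOrbit f x y → InOrbit f y x
    InOrbit-sym {x} (j , refl) with has-period P x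
    ... | p , 1≤p , _ , fᵖx≡x = (p ∸ 1) * j , (begin
        iter f ((p ∸ 1) * j) (iter f j x) ≡⟨ iter-+ f ((p ∸ 1) * j) j x ⟨
        iter f ((p ∸ 1) * j + j) x         ≡⟨ cong (λ m → iter f m x) exponent ⟩
        iter f (j * p) x                   ≡⟨ iter-* f p x fᵖx≡x j ⟩
        x                                  ∎)
      where
      open ≡-Reasoning
      exponent : (p ∸ 1) * j + j ≡ j * p
      exponent = trans (+-comm ((p ∸ 1) * j) j) (trans (cong (_* j) (m+[n∸m]≡n 1≤p)) (*-comm p j))

    iter-mod-period : ∀ {p x} .{{_ : NonZero p}} → iter f p x ≡ x → ∀ j → iter f j x ≡ iter f (j % p) x
    iter-mod-period {p} {x} fᵖx≡x j =
      trans (cong (λ m → iter f m x) (m≡m%n+[m/n]*n j p))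
        (trans (iter-+ f (j % p) ((j / p) * p) x) (cong (iter f (j % p)) (iter-* f p x fᵖx≡x (j / p))))

    InOrbit-bounded : ∀ {x y} → InOrbit f x y → ∃ λ j → j < k × iter f j x ≡ y
    InOrbit-bounded {x} (j , eq) with has-period P x
    ... | p@(suc _) , _ , p≤k , fᵖx≡x =
      j % p , ≤-trans (m%n<n j p) p≤k , trans (sym (iter-mod-period fᵖx≡x j)) eq

    InOrbit? : ∀ x y → Dec (InOrbit f x y)
    InOrbit? x y with anyUpTo? (λ j → iter f j x Fin.≟ y) k
    ... | yes (j , _ , eq) = yes (j , eq)
    ... | no ¬bounded      = no (¬bounded ∘ InOrbit-bounded)

    isOrbitMin⇒ : ∀ d → isOrbitMin f d ≡ true → ∀ {e} → InOrbit f d e → toℕ d ≤ toℕ e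
    isOrbitMin⇒ d min o with InOrbit-bounded o
    ... | j , j<k , refl = ≤ᵇ≡true⇒≤
      (all-applyUpTo⁻ (λ j → toℕ d ≤ᵇ toℕ (iter f j d)) (λ j → j) k min j j<k)

    isOrbitMin⇐ : ∀ d → (∀ {e} → InOrbit f d e → toℕ d ≤ toℕ e) → isOrbitMin f d ≡ true
    isOrbitMin⇐ d min = all-applyUpTo⁺ (λ j → toℕ d ≤ᵇ toℕ (iter f j d)) (λ j → j) k
      (λ j _ → dec-true (toℕ d ≤? _) (min (j , refl)))

    one-orbit⇒one-orbitMin : (S : Fin k → Bool) (w : Fin k) → S w ≡ true →
      (∀ d → S d ≡ true → S (f d) ≡ true) →
      (∀ d e → S d ≡ true → S e ≡ true → InOrbit f d e) →
      orbitMinimaIn S f ≡ 1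
    one-orbit⇒one-orbitMin S w Sw closed connected with minimal-Fin S w Sw
    ... | m , Sm , m-min = sum-of-unique (λ d → S d ∧ isOrbitMin f d) m Sm∧min unique
      where
      Sm∧min : (S m ∧ isOrbitMin f m) ≡ true
      Sm∧min rewrite Sm = isOrbitMin⇐ m (λ o → m-min _ (InOrbit-closed S closed Sm o))
      unique : ∀ d → (S d ∧ isOrbitMin f d) ≡ true → d ≡ m
      unique d h with S d in Sd
      ... | true = toℕ-injective (≤-antisym (isOrbitMin⇒ d h (connected d m Sd Sm)) (m-min d Sd))

isOrbitMin-cong-iter : ∀ {k} {f g : Fin k → Fin k} {d} → (∀ j → iter f j d ≡ iter g j d) →
  isOrbitMin f d ≡ isOrbitMin g d
isOrbitMin-cong-iter {k} {d = d} same = all-cong (λ j → cong (λ z → toℕ d ≤ᵇ toℕ z) (same j)) (upTo k)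

isOrbitMin-cong : ∀ {k} {f g : Fin k → Fin k} → (∀ x → f x ≡ g x) → ∀ d → isOrbitMin f d ≡ isOrbitMin g d
isOrbitMin-cong f≗g d = isOrbitMin-cong-iter (λ j → iter-cong f≗g j d)

numOrbits-cong : ∀ {k} {f g : Fin k → Fin k} → (∀ x → f x ≡ g x) → numOrbits f ≡ numOrbits g
numOrbits-cong {k} f≗g = countᵇ-cong (isOrbitMin-cong f≗g) (allFin k)

numOrbits≡orbitMinimaIn : ∀ {k} (g : Fin k → Fin k) → numOrbits g ≡ orbitMinimaIn (λ _ → true) g
numOrbits≡orbitMinimaIn g = countᵇ-allFin (isOrbitMin g)

orbitMinimaIn-split : ∀ {k} (S T : Fin k → Bool) g →
  orbitMinimaIn S g ≡ orbitMinimaIn (λ d → S d ∧ T d) g + orbitMinimaIn (λ d → S d ∧ not (T d)) g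
orbitMinimaIn-split {k} S T g =
  trans (sum-cong-≗ (λ d → split (S d) (T d) (isOrbitMin g d))) (∑-distrib-+ {k} _ _)
  where
  split : ∀ s t x → indicator (s ∧ x) ≡ indicator ((s ∧ t) ∧ x) + indicator ((s ∧ not t) ∧ x)
  split false t     x = refl
  split true  true  x = sym (+-identityʳ _)
  split true  false x = refl

orbitMinimaIn-cong : ∀ {k} (S : Fin k → Bool) {f g : Fin k → Fin k} →
  (∀ d → S d ≡ true → isOrbitMin f d ≡ isOrbitMin g d) → orbitMinimaIn S f ≡ orbitMinimaIn S g
orbitMinimaIn-cong S {f} {g} agree = sum-cong-≗ λ d → cong indicator (pointwise d)
  where
  pointwise : ∀ d → (S d ∧ isOrbitMin f d) ≡ (S d ∧ isOrbitMin g d)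
  pointwise d with S d in Sd
  ... | true  = agree d Sd
  ... | false = refl

module _ {k : ℕ} (a b : Fin k) where

  transpose-cases : ∀ d →
    (d ≡ a × transpose a b d ≡ b) ⊎
    (d ≢ a × d ≡ b × transpose a b d ≡ a) ⊎
    (d ≢ a × d ≢ b × transpose a b d ≡ d)
  transpose-cases d with does (d Fin.≟ a) in d≟a
  ... | true = inj₁ (does-true (d Fin.≟ a) d≟a , refl)
  ... | false with does (d Fin.≟ b) in d≟b
  ...   | true  = inj₂ (inj₁ (does-false (d Fin.≟ a) d≟a , does-true (d Fin.≟ b) d≟b , refl))
  ...   | false = inj₂ (inj₂ (does-false (d Fin.≟ a) d≟a , does-false (d Fin.≟ b) d≟b , refl))

  transpose-left : transpose a b a ≡ b
  transpose-left with transpose-cases a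
  ... | inj₁ (_ , eq)                = eq
  ... | inj₂ (inj₁ (a≢a , _))        = ⊥-elim (a≢a refl)
  ... | inj₂ (inj₂ (a≢a , _))        = ⊥-elim (a≢a refl)

  transpose-right : transpose a b b ≡ a
  transpose-right with transpose-cases b
  ... | inj₁ (b≡a , eq)              = trans eq b≡a
  ... | inj₂ (inj₁ (_ , _ , eq))     = eq
  ... | inj₂ (inj₂ (_ , b≢b , _))    = ⊥-elim (b≢b refl)

  transpose-other : ∀ {d} → d ≢ a → d ≢ b → transpose a b d ≡ d
  transpose-other {d} d≢a d≢b with transpose-cases d
  ... | inj₁ (d≡a , _)               = ⊥-elim (d≢a d≡a)
  ... | inj₂ (inj₁ (_ , d≡b , _))    = ⊥-elim (d≢b d≡b)
  ... | inj₂ (inj₂ (_ , _ , eq))     = eq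

  transpose-involutive : ∀ d → transpose a b (transpose a b d) ≡ d
  transpose-involutive d with transpose-cases d
  ... | inj₁ (refl , eq)             = trans (cong (transpose a b) eq) transpose-right
  ... | inj₂ (inj₁ (_ , refl , eq))  = trans (cong (transpose a b) eq) transpose-left
  ... | inj₂ (inj₂ (_ , _ , eq))     = trans (cong (transpose a b) eq) eq

  ∘transpose-IsPermutation : ∀ {f : Fin k → Fin k} → IsPermutation f → IsPermutation (f ∘ transpose a b)
  ∘transpose-IsPermutation P =
    IsPermutation-∘ P (involution⇒IsPermutation transpose-involutive)

transpose-refl : ∀ {k} (a d : Fin k) → transpose a a d ≡ d
transpose-refl a d with transpose-cases a a d
... | inj₁ (d≡a , eq)            = trans eq (sym d≡a)
... | inj₂ (inj₁ (d≢a , d≡a , _)) = ⊥-elim (d≢a d≡a)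
... | inj₂ (inj₂ (_ , _ , eq))   = eq

module Split {k : ℕ} {f : Fin k → Fin k} (P : IsPermutation f) {a b : Fin k}
  (a≢b : a ≢ b) (a⇝b : InOrbit f a b) where

  f′ : Fin k → Fin k
  f′ = f ∘ transpose a b

  P′ : IsPermutation f′
  P′ = ∘transpose-IsPermutation a b P

  A : ℕ → Fin k
  A j = iter f j a

  open LeastPeriod (leastPeriod P a) using () renaming
    (period to q; period-positive to 1≤q; period-returns to A-q; period-minimal to A-below-q)

  instance
    q-nonZero : NonZero q
    q-nonZero = >-nonZero 1≤q

  A-injective : ∀ {s t} → s < q → t < q → A s ≡ A t → s ≡ t
  A-injective {s} {t} s<q t<q eq with <-cmp s t
  ... | tri≈ _ s≡t _ = s≡t
  ... | tri< s<t _ _ = ⊥-elim (A-below-q (t ∸ s) (m<n⇒0<n∸m s<t) (≤-<-trans (m∸n≤m t s) t<q)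
                                (iter-collision P s<t eq))
  ... | tri> _ _ t<s = ⊥-elim (A-below-q (s ∸ t) (m<n⇒0<n∸m t<s) (≤-<-trans (m∸n≤m s t) s<q)
                                (iter-collision P t<s (sym eq)))

  i : ℕ
  i = proj₁ a⇝b % q

  i<q : i < q
  i<q = m%n<n (proj₁ a⇝b) q

  A-i : A i ≡ b
  A-i = trans (sym (iter-mod-period P A-q (proj₁ a⇝b))) (proj₂ a⇝b)

  i≢0 : i ≢ 0
  i≢0 i≡0 = a≢b (trans (cong A (sym i≡0)) A-i)

  f′-a : f′ a ≡ A (suc i)
  f′-a = cong f (trans (transpose-left a b) (sym A-i))

  f′-b : f′ b ≡ A 1
  f′-b = cong f (transpose-right a b)

  f′-A : ∀ {j} → j < q → j ≢ 0 → j ≢ i → f′ (A j) ≡ A (suc j)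
  f′-A {j} j<q j≢0 j≢i = cong f (transpose-other a b
    (j≢0 ∘ A-injective j<q 1≤q)
    (λ Aj≡b → j≢i (A-injective j<q i<q (trans Aj≡b (sym A-i)))))

  inOrbit : Fin k → Bool
  inOrbit d = does (InOrbit? P a d)

  inOrbit-A : ∀ j → inOrbit (A j) ≡ true
  inOrbit-A j = dec-true (InOrbit? P a (A j)) (j , refl)

  inFirstArc : Fin k → Bool
  inFirstArc d = does (anyUpTo? (λ j → A (suc j) Fin.≟ d) i)

  -- f′ cuts the cycle A 0, …, A (q - 1) of f into the cycles A 1, …, A i (as f′ b = A 1)
  -- and A 0, A (i + 1), …, A (q - 1) (as f′ a = A (i + 1)); the other cycles are untouched.
  arc₁ arc₂ : Fin k → Bool
  arc₁ d = inOrbit d ∧ inFirstArc d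
  arc₂ d = inOrbit d ∧ not (inFirstArc d)

  arc₁-A : ∀ {j} → j < i → arc₁ (A (suc j)) ≡ true
  arc₁-A {j} j<i rewrite inOrbit-A (suc j) = dec-true (anyUpTo? _ i) (j , j<i , refl)

  arc₁⁻ : ∀ {d} → arc₁ d ≡ true → ∃ λ j → j < i × A (suc j) ≡ d
  arc₁⁻ {d} h with inOrbit d
  ... | true = does-true (anyUpTo? _ i) h

  arc₁-iter : ∀ {j} → j < i → iter f′ j (A 1) ≡ A (suc j)
  arc₁-iter {zero}  _     = refl
  arc₁-iter {suc j} 1+j<i = trans (cong f′ (arc₁-iter (<-trans (n<1+n j) 1+j<i)))
    (f′-A (<-trans 1+j<i i<q) (λ ()) (λ 1+j≡i → <-irrefl 1+j≡i 1+j<i))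

  arc₁-closed : ∀ d → arc₁ d ≡ true → arc₁ (f′ d) ≡ true
  arc₁-closed d h with arc₁⁻ h
  ... | j , j<i , refl with suc j ≟ i
  ...   | yes 1+j≡i = subst (λ x → arc₁ x ≡ true)
                        (sym (trans (cong f′ (trans (cong A 1+j≡i) A-i)) f′-b))
                        (arc₁-A (≤-trans (s≤s z≤n) j<i))
  ...   | no 1+j≢i  = subst (λ x → arc₁ x ≡ true) (sym (f′-A (≤-<-trans j<i i<q) (λ ()) 1+j≢i))
                        (arc₁-A (≤∧≢⇒< j<i 1+j≢i))

  arc₁-connected : ∀ d e → arc₁ d ≡ true → arc₁ e ≡ true → InOrbit f′ d e
  arc₁-connected d e hd he with arc₁⁻ hd | arc₁⁻ he
  ... | j , j<i , refl | j′ , j′<i , refl =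
    InOrbit-trans (InOrbit-sym P′ (j , arc₁-iter j<i)) (j′ , arc₁-iter j′<i)

  arc₁-orbitMin : orbitMinimaIn arc₁ f′ ≡ 1
  arc₁-orbitMin = one-orbit⇒one-orbitMin P′ arc₁ (A 1) (arc₁-A (n≢0⇒n>0 i≢0)) arc₁-closed arc₁-connected

  arc₂-A : ∀ {j} → j < q → j ≡ 0 ⊎ i < j → arc₂ (A j) ≡ true
  arc₂-A {j} j<q j-outside rewrite inOrbit-A j =
    cong not (dec-false (anyUpTo? _ i) λ { (j′ , j′<i , eq) →
      outside (A-injective (≤-<-trans j′<i i<q) j<q eq) j′<i j-outside })
    where
    outside : ∀ {j′} → suc j′ ≡ j → j′ < i → j ≡ 0 ⊎ i < j → ⊥
    outside refl _    (inj₁ ())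
    outside refl j′<i (inj₂ i<j) = <⇒≱ j′<i (≤-pred i<j)

  arc₂-q : ∀ {j} → j ≤ q → i < j → arc₂ (A j) ≡ true
  arc₂-q {j} j≤q i<j with m≤n⇒m<n∨m≡n j≤q
  ... | inj₁ j<q  = arc₂-A j<q (inj₂ i<j)
  ... | inj₂ refl = subst (λ x → arc₂ x ≡ true) (sym A-q) (arc₂-A 1≤q (inj₁ refl))

  arc₂⁻ : ∀ {d} → arc₂ d ≡ true → ∃ λ j → j < q × (j ≡ 0 ⊎ i < j) × A j ≡ d
  arc₂⁻ {d} h with inOrbit d in inOrbit-d
  ... | true with does-true (InOrbit? P a d) inOrbit-d
  ...   | j , refl = j % q , m%n<n j q , classify (j % q) refl , sym (iter-mod-period P A-q j)
    where
    notFirst : ∀ {j′} → j′ < i → A (suc j′) ≢ A j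
    notFirst j′<i eq with () ← trans (sym h) (cong not (dec-true (anyUpTo? _ i) (_ , j′<i , eq)))
    A-mod : ∀ {r} → suc r ≡ j % q → A (suc r) ≡ A j
    A-mod r≡ = trans (cong A r≡) (sym (iter-mod-period P A-q j))
    classify : ∀ r → r ≡ j % q → r ≡ 0 ⊎ i < r
    classify zero    _    = inj₁ refl
    classify (suc r) r≡ with <-cmp i (suc r)
    ... | tri< i<r _ _ = inj₂ i<r
    ... | tri≈ _ i≡r _ = ⊥-elim (notFirst (subst (r <_) (sym i≡r) (n<1+n r)) (A-mod r≡))
    ... | tri> _ _ r<i = ⊥-elim (notFirst (<-trans (n<1+n r) r<i) (A-mod r≡))

  arc₂-closed : ∀ d → arc₂ d ≡ true → arc₂ (f′ d) ≡ true
  arc₂-closed d h with arc₂⁻ h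
  ... | zero  , _   , _          , refl = subst (λ x → arc₂ x ≡ true) (sym f′-a) (arc₂-q i<q (n<1+n i))
  ... | suc j , j<q , inj₂ i<1+j , refl =
    subst (λ x → arc₂ x ≡ true) (sym (f′-A j<q (λ ()) (λ 1+j≡i → <-irrefl (sym 1+j≡i) i<1+j)))
      (arc₂-q j<q (<-trans i<1+j (n<1+n _)))

  arc₂-iter : ∀ {s} → 1 ≤ s → i + s < q → iter f′ s a ≡ A (i + s)
  arc₂-iter {suc zero}    _ _   = trans f′-a (cong A (+-comm 1 i))
  arc₂-iter {suc (suc s)} _ i+s<q =
    trans (cong f′ (arc₂-iter (s≤s z≤n) i+s′<q))
      (trans (f′-A i+s′<q (i≢0 ∘ m+n≡0⇒m≡0 i) (m+1+n≢m i)) (cong A (sym (+-suc i (suc s)))))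
    where
    i+s′<q : i + suc s < q
    i+s′<q = <-trans (+-monoʳ-< i (n<1+n _)) i+s<q

  arc₂-reach : ∀ {d} → arc₂ d ≡ true → InOrbit f′ a d
  arc₂-reach h with arc₂⁻ h
  ... | zero  , _   , _          , refl = InOrbit-refl
  ... | suc j , j<q , inj₂ i<1+j , refl =
    suc j ∸ i ,
    trans (arc₂-iter (m<n⇒0<n∸m i<1+j) (subst (_< q) (sym (m+[n∸m]≡n (<⇒≤ i<1+j))) j<q))
      (cong A (m+[n∸m]≡n (<⇒≤ i<1+j)))

  arc₂-orbitMin : orbitMinimaIn arc₂ f′ ≡ 1
  arc₂-orbitMin = one-orbit⇒one-orbitMin P′ arc₂ a (arc₂-A 1≤q (inj₁ refl)) arc₂-closed
    λ d e hd he → InOrbit-trans (InOrbit-sym P′ (arc₂-reach hd)) (arc₂-reach he)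

  orbit-orbitMin : orbitMinimaIn inOrbit f ≡ 1
  orbit-orbitMin = one-orbit⇒one-orbitMin P inOrbit a (inOrbit-A 0)
    (λ d h → dec-true (InOrbit? P a (f d)) (InOrbit-step (does-true (InOrbit? P a d) h)))
    (λ d e hd he → InOrbit-trans (InOrbit-sym P (does-true (InOrbit? P a d) hd))
                                 (does-true (InOrbit? P a e) he))

  iter-outside : ∀ {d} → inOrbit d ≡ false → ∀ j → iter f′ j d ≡ iter f j d
  iter-outside d∉ zero    = refl
  iter-outside {d} d∉ (suc j) = trans (cong f′ (iter-outside d∉ j)) (cong f (transpose-other a b
    (λ fʲd≡a → a⇝̸d (InOrbit-sym P (j , fʲd≡a)))
    (λ fʲd≡b → a⇝̸d (InOrbit-trans a⇝b (InOrbit-sym P (j , fʲd≡b))))))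
    where
    a⇝̸d : ¬ InOrbit f a d
    a⇝̸d = does-false (InOrbit? P a d) d∉

  outside-orbitMin : orbitMinimaIn (not ∘ inOrbit) f′ ≡ orbitMinimaIn (not ∘ inOrbit) f
  outside-orbitMin = orbitMinimaIn-cong (not ∘ inOrbit) agree
    where
    agree : ∀ d → not (inOrbit d) ≡ true → isOrbitMin f′ d ≡ isOrbitMin f d
    agree d h with inOrbit d in d∉
    ... | false = isOrbitMin-cong-iter (iter-outside d∉)

  numOrbits-∘transpose : numOrbits f′ ≡ suc (numOrbits f)
  numOrbits-∘transpose = begin
    numOrbits f′
      ≡⟨ numOrbits≡orbitMinimaIn f′ ⟩
    orbitMinimaIn (λ _ → true) f′
      ≡⟨ orbitMinimaIn-split (λ _ → true) inOrbit f′ ⟩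
    orbitMinimaIn inOrbit f′ + orbitMinimaIn (not ∘ inOrbit) f′
      ≡⟨ cong₂ _+_ (trans (orbitMinimaIn-split inOrbit inFirstArc f′)
                          (cong₂ _+_ arc₁-orbitMin arc₂-orbitMin))
                   outside-orbitMin ⟩
    2 + orbitMinimaIn (not ∘ inOrbit) f
      ≡⟨ cong (λ n → suc (n + orbitMinimaIn (not ∘ inOrbit) f)) orbit-orbitMin ⟨
    suc (orbitMinimaIn inOrbit f + orbitMinimaIn (not ∘ inOrbit) f)
      ≡⟨ cong suc (orbitMinimaIn-split (λ _ → true) inOrbit f) ⟨
    suc (orbitMinimaIn (λ _ → true) f)
      ≡⟨ cong suc (numOrbits≡orbitMinimaIn f) ⟨
    suc (numOrbits f) ∎
    where open ≡-Reasoning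

module Merge {k : ℕ} {f : Fin k → Fin k} (P : IsPermutation f) {a b : Fin k}
  (a⇝̸b : ¬ InOrbit f a b) where

  f′ : Fin k → Fin k
  f′ = f ∘ transpose a b

  P′ : IsPermutation f′
  P′ = ∘transpose-IsPermutation a b P

  a≢b : a ≢ b
  a≢b refl = a⇝̸b InOrbit-refl

  open LeastPeriod (leastPeriod P b) using () renaming
    (period to q; period-positive to 1≤q; period-returns to fᵠb≡b; period-minimal to fˢb≢b)

  f′-follows-b : ∀ {s} → 1 ≤ s → s ≤ q → iter f′ s a ≡ iter f s b
  f′-follows-b {suc zero}    _ _ = cong f (transpose-left a b)
  f′-follows-b {suc (suc s)} _ 2+s≤q = trans (cong f′ (f′-follows-b (s≤s z≤n) (<⇒≤ 2+s≤q)))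
    (cong f (transpose-other a b
      (λ fˢb≡a → a⇝̸b (InOrbit-sym P (suc s , fˢb≡a)))
      (fˢb≢b (suc s) (s≤s z≤n) 2+s≤q)))

  a⇝b : InOrbit f′ a b
  a⇝b = q , trans (f′-follows-b 1≤q ≤-refl) fᵠb≡b

  numOrbits-∘transpose : numOrbits f ≡ suc (numOrbits f′)
  numOrbits-∘transpose =
    trans (numOrbits-cong (λ x → cong f (sym (transpose-involutive a b x))))
          (Split.numOrbits-∘transpose P′ a≢b a⇝b)

numOrbits-∘transpose-≤ : ∀ {k} {f : Fin k → Fin k} → IsPermutation f → (a b : Fin k) →
  numOrbits (f ∘ transpose a b) ≤ suc (numOrbits f)
numOrbits-∘transpose-≤ {f = f} P a b with a Fin.≟ b
... | yes refl = ≤-trans (≤-reflexive (numOrbits-cong (cong f ∘ transpose-refl a))) (n≤1+n _)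
... | no a≢b with InOrbit? P a b
...   | yes a⇝b  = ≤-reflexive (Split.numOrbits-∘transpose P a≢b a⇝b)
...   | no a⇝̸b  = ≤-trans (n≤1+n _) (≤-trans (≤-reflexive (sym (Merge.numOrbits-∘transpose P a⇝̸b))) (n≤1+n _))

module FixedPointFreeInvolution {k : ℕ} {α : Fin k → Fin k}
  (α-involutive : ∀ d → α (α d) ≡ d) (α-nofix : ∀ d → α d ≢ d) where

  Pα : IsPermutation α
  Pα = involution⇒IsPermutation α-involutive

  isPairMin : Fin k → Bool
  isPairMin d = toℕ d ≤ᵇ toℕ (α d)

  InOrbit-α : ∀ {d e} → InOrbit α d e → e ≡ d ⊎ e ≡ α d
  InOrbit-α (zero , refl) = inj₁ refl
  InOrbit-α {d} (suc j , refl) with InOrbit-α {d} (j , refl)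
  ... | inj₁ eq = inj₂ (cong α eq)
  ... | inj₂ eq = inj₁ (trans (cong α eq) (α-involutive d))

  isOrbitMin-α : ∀ d → isOrbitMin α d ≡ isPairMin d
  isOrbitMin-α d = ⇔→≡ {z = true} (mk⇔
    (λ min → dec-true (toℕ d ≤? _) (isOrbitMin⇒ Pα d min (1 , refl)))
    (λ pairMin → isOrbitMin⇐ Pα d λ o → below pairMin (InOrbit-α o)))
    where
    below : isPairMin d ≡ true → ∀ {e} → e ≡ d ⊎ e ≡ α d → toℕ d ≤ toℕ e
    below _       (inj₁ refl) = ≤-refl
    below pairMin (inj₂ refl) = ≤ᵇ≡true⇒≤ pairMin

  toℕ-α-≢ : ∀ d → toℕ d ≢ toℕ (α d)
  toℕ-α-≢ d eq = α-nofix d (sym (toℕ-injective eq))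

  isPairMin-exactly-one : ∀ d → indicator (isPairMin d) + indicator (isPairMin (α d)) ≡ 1
  isPairMin-exactly-one d rewrite α-involutive d with ≤-total (toℕ d) (toℕ (α d))
  ... | inj₁ d≤αd rewrite dec-true (toℕ d ≤? _) d≤αd
                        | dec-false (toℕ (α d) ≤? _) (λ αd≤d → toℕ-α-≢ d (≤-antisym d≤αd αd≤d)) = refl
  ... | inj₂ αd≤d rewrite dec-true (toℕ (α d) ≤? _) αd≤d
                        | dec-false (toℕ d ≤? _) (λ d≤αd → toℕ-α-≢ d (≤-antisym d≤αd αd≤d)) = refl

  twice-orbitMinima : (c : Fin k → Bool) → (∀ d → c (α d) ≡ c d) →
    2 * countᵇ (λ d → isOrbitMin α d ∧ c d) (allFin k) ≡ countᵇ c (allFin k)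
  twice-orbitMinima c c-α = begin
    2 * countᵇ (λ d → isOrbitMin α d ∧ c d) (allFin k)
      ≡⟨ cong (2 *_) (trans (countᵇ-allFin {k} _)
           (sum-cong-≗ {k} (λ d → cong (λ m → indicator (m ∧ c d)) (isOrbitMin-α d)))) ⟩
    2 * pairMinSum
      ≡⟨ cong (pairMinSum +_) (trans (+-identityʳ pairMinSum)
           (sym (sum-∘IsPermutation Pα (λ d → indicator (isPairMin d ∧ c d))))) ⟩
    pairMinSum + sum (λ d → indicator (isPairMin (α d) ∧ c (α d)))
      ≡⟨ ∑-distrib-+ {k} _ _ ⟨
    sum (λ d → indicator (isPairMin d ∧ c d) + indicator (isPairMin (α d) ∧ c (α d)))
      ≡⟨ sum-cong-≗ pointwise ⟩
    sum (indicator ∘ c)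
      ≡⟨ countᵇ-allFin c ⟨
    countᵇ c (allFin k) ∎
    where
    open ≡-Reasoning
    pairMinSum : ℕ
    pairMinSum = sum (λ d → indicator (isPairMin d ∧ c d))
    pointwise : ∀ d → indicator (isPairMin d ∧ c d) + indicator (isPairMin (α d) ∧ c (α d)) ≡ indicator (c d)
    pointwise d rewrite c-α d with c d
    ... | false rewrite ∧-zeroʳ (isPairMin d) | ∧-zeroʳ (isPairMin (α d)) = refl
    ... | true  rewrite ∧-identityʳ (isPairMin d) | ∧-identityʳ (isPairMin (α d)) = isPairMin-exactly-one d

  twice-numOrbits : 2 * numOrbits α ≡ k
  twice-numOrbits = begin
    2 * numOrbits α                                   ≡⟨ cong (2 *_) (countᵇ-cong (λ d → sym (∧-identityʳ _)) (allFin k)) ⟩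
    2 * countᵇ (λ d → isOrbitMin α d ∧ true) (allFin k) ≡⟨ twice-orbitMinima (λ _ → true) (λ _ → refl) ⟩
    countᵇ (λ _ → true) (allFin k)                    ≡⟨ countᵇ-allFin {k} (λ _ → true) ⟩
    sum (λ (_ : Fin k) → 1)                           ≡⟨ sum-ones k ⟩
    k                                                 ∎
    where open ≡-Reasoning

  pairMin : Fin k → ℕ
  pairMin d = toℕ d ⊓ toℕ (α d)

  pairMin-α : ∀ d → pairMin (α d) ≡ pairMin d
  pairMin-α d = trans (cong (toℕ (α d) ⊓_) (cong toℕ (α-involutive d))) (⊓-comm (toℕ (α d)) (toℕ d))

  pairMin≡toℕ⇒ : ∀ {d x} → pairMin d ≡ toℕ x → d ≡ x ⊎ d ≡ α x
  pairMin≡toℕ⇒ {d} eq with ≤-total (toℕ d) (toℕ (α d))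
  ... | inj₁ d≤αd = inj₁ (toℕ-injective (trans (sym (m≤n⇒m⊓n≡m d≤αd)) eq))
  ... | inj₂ αd≤d = inj₂ (trans (sym (α-involutive d))
                           (cong α (toℕ-injective (trans (sym (m≥n⇒m⊓n≡n αd≤d)) eq))))

  -- α< 0 = id and α< k = α, and each step multiplies by at most one transposition (d, α d).
  α< : ℕ → Fin k → Fin k
  α< j d = if pairMin d <ᵇ j then α d else d

  α<-involutive : ∀ j d → α< j (α< j d) ≡ d
  α<-involutive j d with pairMin d <ᵇ j in below
  ... | true  rewrite pairMin-α d | below = α-involutive d
  ... | false rewrite below = refl

  α<-inside : ∀ {j d} → pairMin d < j → α< j d ≡ α d
  α<-inside {j} {d} lt rewrite dec-true (pairMin d <? j) lt = refl

  α<-outside : ∀ {j d} → ¬ pairMin d < j → α< j d ≡ d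
  α<-outside {j} {d} ¬lt rewrite dec-false (pairMin d <? j) ¬lt = refl

  α<-suc-other : ∀ {j d} → pairMin d ≢ j → α< (suc j) d ≡ α< j d
  α<-suc-other pairMin≢j rewrite <ᵇ-suc pairMin≢j = refl

  pairMinsBelow : ℕ → ℕ
  pairMinsBelow j = sum (λ d → indicator ((toℕ d <ᵇ j) ∧ isPairMin d))

  pairMinsBelow-zero : pairMinsBelow 0 ≡ 0
  pairMinsBelow-zero = sum-of-false _ (λ d → cong (_∧ isPairMin d) (dec-false (toℕ d <? 0) λ ()))

  pairMinsBelow-k : pairMinsBelow k ≡ numOrbits α
  pairMinsBelow-k = trans (sum-cong-≗ {k} (λ d → cong indicator
      (trans (cong (_∧ isPairMin d) (dec-true (toℕ d <? k) (toℕ<n d))) (sym (isOrbitMin-α d)))))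
    (sym (countᵇ-allFin (isOrbitMin α)))

  module _ (j : ℕ) (j<k : j < k) where

    private
      x : Fin k
      x = fromℕ< j<k

      toℕ-x : toℕ x ≡ j
      toℕ-x = toℕ-fromℕ< j<k

    pairMinsBelow-suc : pairMinsBelow (suc j) ≡ pairMinsBelow j + indicator (isPairMin x)
    pairMinsBelow-suc = trans (sum-cong-≗ {k} pointwise)
      (trans (∑-distrib-+ {k} _ _) (cong (pairMinsBelow j +_) (sum-indicator-at x isPairMin)))
      where
      pointwise : ∀ d → indicator ((toℕ d <ᵇ suc j) ∧ isPairMin d)
                      ≡ indicator ((toℕ d <ᵇ j) ∧ isPairMin d) + indicator (does (d Fin.≟ x) ∧ isPairMin d)
      pointwise d with d Fin.≟ x
      ... | yes refl rewrite toℕ-x | dec-true (j <? suc j) (n<1+n j) | dec-false (j <? j) (<-irrefl refl) = refl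
      ... | no d≢x   rewrite <ᵇ-suc (λ eq → d≢x (toℕ-injective (trans eq (sym toℕ-x)))) = sym (+-identityʳ _)

    pairMin-x : isPairMin x ≡ true → pairMin x ≡ j
    pairMin-x pm = trans (m≤n⇒m⊓n≡m (≤ᵇ≡true⇒≤ pm)) toℕ-x

    α<-suc-pairMin : isPairMin x ≡ true → ∀ d → α< (suc j) d ≡ α< j (transpose x (α x) d)
    α<-suc-pairMin pm d with transpose-cases x (α x) d
    ... | inj₁ (refl , τd) = begin
      α< (suc j) x          ≡⟨ α<-inside (≤-reflexive (cong suc (pairMin-x pm))) ⟩
      α x                   ≡⟨ α<-outside (<-irrefl (trans (pairMin-α x) (pairMin-x pm))) ⟨
      α< j (α x)            ≡⟨ cong (α< j) τd ⟨
      α< j (transpose x (α x) x) ∎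
      where open ≡-Reasoning
    ... | inj₂ (inj₁ (_ , refl , τd)) = begin
      α< (suc j) (α x)      ≡⟨ α<-inside (≤-reflexive (cong suc (trans (pairMin-α x) (pairMin-x pm)))) ⟩
      α (α x)               ≡⟨ α-involutive x ⟩
      x                     ≡⟨ α<-outside (<-irrefl (pairMin-x pm)) ⟨
      α< j x                ≡⟨ cong (α< j) τd ⟨
      α< j (transpose x (α x) (α x)) ∎
      where open ≡-Reasoning
    ... | inj₂ (inj₂ (d≢x , d≢αx , τd)) =
      trans (α<-suc-other pairMin≢j) (cong (α< j) (sym τd))
      where
      pairMin≢j : pairMin d ≢ j
      pairMin≢j eq with pairMin≡toℕ⇒ (trans eq (sym toℕ-x))
      ... | inj₁ d≡x  = d≢x d≡x
      ... | inj₂ d≡αx = d≢αx d≡αx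

    α<-suc-nonPairMin : isPairMin x ≡ false → ∀ d → α< (suc j) d ≡ α< j d
    α<-suc-nonPairMin npm d = α<-suc-other pairMin≢j
      where
      αx<x : toℕ (α x) < toℕ x
      αx<x = ≰⇒> (does-false (toℕ x ≤? _) npm)
      pairMin-x≢j : pairMin x ≢ j
      pairMin-x≢j eq = <-irrefl (trans eq (sym toℕ-x)) (≤-<-trans (m⊓n≤n (toℕ x) _) αx<x)
      pairMin≢j : pairMin d ≢ j
      pairMin≢j eq with pairMin≡toℕ⇒ (trans eq (sym toℕ-x))
      ... | inj₁ refl = pairMin-x≢j eq
      ... | inj₂ refl = pairMin-x≢j (trans (sym (pairMin-α x)) eq)

  module _ {σ : Fin k → Fin k} (Pσ : IsPermutation σ) where

    numOrbits-∘α< : ∀ j → j ≤ k → numOrbits (σ ∘ α< j) ≤ numOrbits σ + pairMinsBelow j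
    numOrbits-∘α< zero _ = ≤-reflexive (begin
      numOrbits (σ ∘ α< 0)          ≡⟨ numOrbits-cong (λ d → cong σ (α<-outside {0} {d} λ ())) ⟩
      numOrbits σ                   ≡⟨ +-identityʳ _ ⟨
      numOrbits σ + 0               ≡⟨ cong (numOrbits σ +_) pairMinsBelow-zero ⟨
      numOrbits σ + pairMinsBelow 0 ∎)
      where open ≡-Reasoning
    numOrbits-∘α< (suc j) j<k with isPairMin (fromℕ< j<k) in pm
    ... | true = begin
      numOrbits (σ ∘ α< (suc j))
        ≡⟨ numOrbits-cong (cong σ ∘ α<-suc-pairMin j j<k pm) ⟩
      numOrbits (σ ∘ α< j ∘ transpose x (α x))
        ≤⟨ numOrbits-∘transpose-≤ (IsPermutation-∘ Pσ (involution⇒IsPermutation (α<-involutive j))) x (α x) ⟩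
      suc (numOrbits (σ ∘ α< j))
        ≤⟨ s≤s (numOrbits-∘α< j (<⇒≤ j<k)) ⟩
      suc (numOrbits σ + pairMinsBelow j)
        ≡⟨ +-suc _ _ ⟨
      numOrbits σ + suc (pairMinsBelow j)
        ≡⟨ cong (numOrbits σ +_) (trans (cong (λ b → pairMinsBelow j + indicator b) pm) (+-comm _ 1)) ⟨
      numOrbits σ + (pairMinsBelow j + indicator (isPairMin x))
        ≡⟨ cong (numOrbits σ +_) (pairMinsBelow-suc j j<k) ⟨
      numOrbits σ + pairMinsBelow (suc j) ∎
      where
      open ≤-Reasoning
      x = fromℕ< j<k
    ... | false = begin
      numOrbits (σ ∘ α< (suc j))
        ≡⟨ numOrbits-cong (cong σ ∘ α<-suc-nonPairMin j j<k pm) ⟩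
      numOrbits (σ ∘ α< j)
        ≤⟨ numOrbits-∘α< j (<⇒≤ j<k) ⟩
      numOrbits σ + pairMinsBelow j
        ≡⟨ cong (numOrbits σ +_) (trans (cong (λ b → pairMinsBelow j + indicator b) pm) (+-identityʳ _)) ⟨
      numOrbits σ + (pairMinsBelow j + indicator (isPairMin (fromℕ< j<k)))
        ≡⟨ cong (numOrbits σ +_) (pairMinsBelow-suc j j<k) ⟨
      numOrbits σ + pairMinsBelow (suc j) ∎
      where open ≤-Reasoning

    numOrbits-∘α-≤ : numOrbits (σ ∘ α) ≤ numOrbits σ + numOrbits α
    numOrbits-∘α-≤ = begin
      numOrbits (σ ∘ α)             ≡⟨ numOrbits-cong (λ d → cong σ (α<-inside (≤-<-trans (m⊓n≤m _ _) (toℕ<n d)))) ⟨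
      numOrbits (σ ∘ α< k)          ≤⟨ numOrbits-∘α< k ≤-refl ⟩
      numOrbits σ + pairMinsBelow k ≡⟨ cong (numOrbits σ +_) pairMinsBelow-k ⟩
      numOrbits σ + numOrbits α     ∎
      where open ≤-Reasoning

≤ᵇ-flip : ∀ {a b} → a ≢ b → (b ≤ᵇ a) ≡ not (a ≤ᵇ b)
≤ᵇ-flip {a} {b} a≢b with ≤-total a b
... | inj₁ a≤b rewrite dec-true (a ≤? b) a≤b = dec-false (b ≤? a) (a≢b ∘ ≤-antisym a≤b)
... | inj₂ b≤a rewrite dec-true (b ≤? a) b≤a = cong not (sym (dec-false (a ≤? b) (λ a≤b → a≢b (≤-antisym a≤b b≤a))))

exactly-one-minimum : ∀ {a b c} → a ≢ b → b ≢ c → c ≢ a →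
  indicator ((a ≤ᵇ b) ∧ (a ≤ᵇ c)) + indicator ((b ≤ᵇ c) ∧ (b ≤ᵇ a)) + indicator ((c ≤ᵇ a) ∧ (c ≤ᵇ b)) ≡ 1
exactly-one-minimum {a} {b} {c} a≢b b≢c c≢a
  rewrite ≤ᵇ-flip a≢b | ≤ᵇ-flip b≢c | ≤ᵇ-flip c≢a
  with a ≤ᵇ b in a≤b | b ≤ᵇ c in b≤c | c ≤ᵇ a in c≤a
... | true  | true  | true  =
  ⊥-elim (a≢b (≤-antisym (≤ᵇ≡true⇒≤ a≤b) (≤-trans (≤ᵇ≡true⇒≤ b≤c) (≤ᵇ≡true⇒≤ c≤a))))
... | true  | true  | false = refl
... | true  | false | true  = refl
... | true  | false | false = refl
... | false | true  | true  = refl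
... | false | true  | false = refl
... | false | false | true  = refl
... | false | false | false =
  ⊥-elim (a≢b (≤-antisym (≤-trans (≤ᵇ≡false⇒≥ c≤a) (≤ᵇ≡false⇒≥ b≤c)) (≤ᵇ≡false⇒≥ a≤b)))

module FixedPointFreeOrder3 {k : ℕ} {σ : Fin k → Fin k}
  (σ-cube : ∀ d → σ (σ (σ d)) ≡ d) (σ-nofix : ∀ d → σ d ≢ d) where

  Pσ : IsPermutation σ
  Pσ = order3⇒IsPermutation σ-cube

  σσ-nofix : ∀ d → σ (σ d) ≢ d
  σσ-nofix d eq = σ-nofix d (sym (trans (sym (σ-cube d)) (cong σ eq)))

  InOrbit-σ : ∀ {d e} → InOrbit σ d e → e ≡ d ⊎ e ≡ σ d ⊎ e ≡ σ (σ d)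
  InOrbit-σ (zero , refl) = inj₁ refl
  InOrbit-σ {d} (suc j , refl) with InOrbit-σ {d} (j , refl)
  ... | inj₁ eq        = inj₂ (inj₁ (cong σ eq))
  ... | inj₂ (inj₁ eq) = inj₂ (inj₂ (cong σ eq))
  ... | inj₂ (inj₂ eq) = inj₁ (trans (cong σ eq) (σ-cube d))

  isOrbitMin-σ : ∀ d → isOrbitMin σ d ≡ ((toℕ d ≤ᵇ toℕ (σ d)) ∧ (toℕ d ≤ᵇ toℕ (σ (σ d))))
  isOrbitMin-σ d = ⇔→≡ {z = true} (mk⇔
    (λ min → cong₂ _∧_ (dec-true (toℕ d ≤? _) (isOrbitMin⇒ Pσ d min (1 , refl)))
                       (dec-true (toℕ d ≤? _) (isOrbitMin⇒ Pσ d min (2 , refl))))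
    (λ min → isOrbitMin⇐ Pσ d λ o → below min (InOrbit-σ o)))
    where
    below : ((toℕ d ≤ᵇ toℕ (σ d)) ∧ (toℕ d ≤ᵇ toℕ (σ (σ d)))) ≡ true →
      ∀ {e} → e ≡ d ⊎ e ≡ σ d ⊎ e ≡ σ (σ d) → toℕ d ≤ toℕ e
    below min (inj₁ refl) = ≤-refl
    below min (inj₂ e) with toℕ d ≤ᵇ toℕ (σ d) in d≤σd | e
    ... | true | inj₁ refl = ≤ᵇ≡true⇒≤ d≤σd
    ... | true | inj₂ refl = ≤ᵇ≡true⇒≤ min

  sum-triples : (g : Fin k → ℕ) → sum (λ d → g d + g (σ d) + g (σ (σ d))) ≡ 3 * sum g
  sum-triples g = begin
    sum (λ d → g d + g (σ d) + g (σ (σ d)))          ≡⟨ ∑-distrib-+ {k} (λ d → g d + g (σ d)) _ ⟩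
    sum (λ d → g d + g (σ d)) + sum (g ∘ σ ∘ σ)      ≡⟨ cong₂ _+_ (∑-distrib-+ {k} g (g ∘ σ))
                                                          (trans (sum-∘IsPermutation Pσ (g ∘ σ)) (sum-∘IsPermutation Pσ g)) ⟩
    sum g + sum (g ∘ σ) + sum g                      ≡⟨ cong (λ s → sum g + s + sum g) (sum-∘IsPermutation Pσ g) ⟩
    sum g + sum g + sum g                            ≡⟨ +-assoc (sum g) _ _ ⟩
    sum g + (sum g + sum g)                          ≡⟨ cong (λ s → sum g + (sum g + s)) (+-identityʳ _) ⟨
    3 * sum g                                        ∎
    where open ≡-Reasoning

  thrice-count : (c : Fin k → Bool) →
    (∀ d → indicator (c d) + indicator (c (σ d)) + indicator (c (σ (σ d))) ≡ 1) → 3 * countᵇ c (allFin k) ≡ k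
  thrice-count c one-per-triple = begin
    3 * countᵇ c (allFin k)                                           ≡⟨ cong (3 *_) (countᵇ-allFin c) ⟩
    3 * sum (indicator ∘ c)                                           ≡⟨ sum-triples (indicator ∘ c) ⟨
    sum (λ d → indicator (c d) + indicator (c (σ d)) + indicator (c (σ (σ d)))) ≡⟨ sum-cong-≗ {k} one-per-triple ⟩
    sum (λ (_ : Fin k) → 1)                                           ≡⟨ sum-ones k ⟩
    k                                                                 ∎
    where open ≡-Reasoning

  thrice-numOrbits : 3 * numOrbits σ ≡ k
  thrice-numOrbits = thrice-count (isOrbitMin σ) one-minimum
    where
    toℕ-≢ : ∀ {x y : Fin k} → x ≢ y → toℕ x ≢ toℕ y
    toℕ-≢ x≢y = x≢y ∘ toℕ-injective
    one-minimum : ∀ d → indicator (isOrbitMin σ d) + indicator (isOrbitMin σ (σ d))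
                          + indicator (isOrbitMin σ (σ (σ d))) ≡ 1
    one-minimum d
      rewrite isOrbitMin-σ d | isOrbitMin-σ (σ d) | isOrbitMin-σ (σ (σ d)) | σ-cube d =
      exactly-one-minimum (toℕ-≢ (σ-nofix d ∘ sym)) (toℕ-≢ (σ-nofix (σ d) ∘ sym)) (toℕ-≢ (σσ-nofix d))

Reach-trans : ∀ {k} {σ α : Fin k → Fin k} {d e f} → Reach σ α d e → Reach σ α e f → Reach σ α d f
Reach-trans r here      = r
Reach-trans r (stepσ s) = stepσ (Reach-trans r s)
Reach-trans r (stepα s) = stepα (Reach-trans r s)

InOrbit⇒Reach : ∀ {k} {σ α : Fin k → Fin k} {d e} → InOrbit σ d e → Reach σ α d e
InOrbit⇒Reach (zero  , refl) = here
InOrbit⇒Reach (suc j , refl) = stepσ (InOrbit⇒Reach (j , refl))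

Connected : ∀ {k} → (Fin k → Fin k) → (Fin k → Fin k) → Set
Connected σ α = ∀ d e → Reach σ α d e

Reach-∘transpose : ∀ {k} {σ α : Fin k → Fin k} → IsPermutation σ → ∀ {x y} →
  InOrbit (σ ∘ transpose x y) x y → ∀ {d e} → Reach σ α d e → Reach (σ ∘ transpose x y) α d e
Reach-∘transpose P x⇝y here      = here
Reach-∘transpose P x⇝y (stepα r) = stepα (Reach-∘transpose P x⇝y r)
Reach-∘transpose {σ = σ} {α} P {x} {y} x⇝y {d} (stepσ {e = e} r) with transpose-cases x y e
... | inj₁ (refl , _) = subst (Reach _ α d) (cong σ (transpose-right e y))
        (stepσ (Reach-trans (Reach-∘transpose P x⇝y r) (InOrbit⇒Reach x⇝y)))
... | inj₂ (inj₁ (_ , refl , _)) = subst (Reach _ α d) (cong σ (transpose-left x e))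
        (stepσ (Reach-trans (Reach-∘transpose P x⇝y r)
                            (InOrbit⇒Reach (InOrbit-sym (∘transpose-IsPermutation x e P) x⇝y))))
... | inj₂ (inj₂ (_ , _ , τe)) = subst (Reach _ α d) (cong σ τe) (stepσ (Reach-∘transpose P x⇝y r))

transpose-conjugate : ∀ {k} {α : Fin k → Fin k} → (∀ d → α (α d) ≡ d) → ∀ x y d →
  transpose x y (α d) ≡ α (transpose (α x) (α y) d)
transpose-conjugate {α = α} α-involutive x y d with transpose-cases (α x) (α y) d
... | inj₁ (refl , τd) = begin
  transpose x y (α (α x)) ≡⟨ cong (transpose x y) (α-involutive x) ⟩
  transpose x y x         ≡⟨ transpose-left x y ⟩
  y                       ≡⟨ α-involutive y ⟨
  α (α y)                 ≡⟨ cong α τd ⟨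
  α (transpose (α x) (α y) (α x)) ∎
  where open ≡-Reasoning
... | inj₂ (inj₁ (_ , refl , τd)) = begin
  transpose x y (α (α y)) ≡⟨ cong (transpose x y) (α-involutive y) ⟩
  transpose x y y         ≡⟨ transpose-right x y ⟩
  x                       ≡⟨ α-involutive x ⟨
  α (α x)                 ≡⟨ cong α τd ⟨
  α (transpose (α x) (α y) (α y)) ∎
  where open ≡-Reasoning
... | inj₂ (inj₂ (d≢αx , d≢αy , τd)) = trans
  (transpose-other x y (λ αd≡x → d≢αx (trans (sym (α-involutive d)) (cong α αd≡x)))
                       (λ αd≡y → d≢αy (trans (sym (α-involutive d)) (cong α αd≡y))))
  (cong α (sym τd))

-- The Euler inequality, by induction on the number of vertices: while some vertex cycle is not
-- closed under α, merging it with the next one along an edge lowers V by one and splits a face,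
-- raising F by one.  Once every vertex cycle is α-closed, connectivity leaves a single one, and
-- F ≤ V + E because σ ∘ α is σ followed by E transpositions, each adding at most one cycle.
module _ {k : ℕ} {α : Fin k → Fin k} (α-involutive : ∀ d → α (α d) ≡ d) (α-nofix : ∀ d → α d ≢ d)
  (dart : Fin k) where

  private
    Pα : IsPermutation α
    Pα = involution⇒IsPermutation α-involutive

  α-closed⇒one-vertex : ∀ {σ : Fin k → Fin k} → IsPermutation σ → Connected σ α →
    (∀ x → InOrbit σ x (α (σ x))) → numOrbits σ ≡ 1
  α-closed⇒one-vertex {σ} P connected α-closed =
    trans (numOrbits≡orbitMinimaIn σ) (one-orbit⇒one-orbitMin P (λ _ → true) dart refl
      (λ _ _ → refl) (λ d e _ _ → Reach⇒InOrbit (connected d e)))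
    where
    Reach⇒InOrbit : ∀ {d e} → Reach σ α d e → InOrbit σ d e
    Reach⇒InOrbit here      = InOrbit-refl
    Reach⇒InOrbit (stepσ r) = InOrbit-step (Reach⇒InOrbit r)
    Reach⇒InOrbit (stepα {e = e} r) = InOrbit-trans (Reach⇒InOrbit r)
      (InOrbit-trans (InOrbit-sym P (1 , inverseʳ P e))
        (subst (λ z → InOrbit σ (inv P e) (α z)) (inverseʳ P e) (α-closed (inv P e))))

  euler-inequality′ : ∀ n {σ : Fin k → Fin k} → IsPermutation σ → numOrbits σ ≡ n → Connected σ α →
    numOrbits σ + numOrbits (σ ∘ α) ≤ numOrbits α + 2
  euler-inequality′ n {σ} P V≡n connected with any? (λ x → ¬? (InOrbit? P x (α (σ x))))
  ... | yes (x , x⇝̸y) = merge n V≡n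
    where
    y = α (σ x)
    σ′ = σ ∘ transpose x y
    V-merge : numOrbits σ ≡ suc (numOrbits σ′)
    V-merge = Merge.numOrbits-∘transpose P x⇝̸y
    αx≢αy : α x ≢ α y
    αx≢αy αx≡αy = x⇝̸y (subst (InOrbit σ x) (IsPermutation-injective Pα αx≡αy) InOrbit-refl)
    αx⇝αy : InOrbit (σ ∘ α) (α x) (α y)
    αx⇝αy = 1 , trans (cong σ (α-involutive x)) (sym (α-involutive (σ x)))
    F-split : numOrbits (σ′ ∘ α) ≡ suc (numOrbits (σ ∘ α))
    F-split = trans (numOrbits-cong (cong σ ∘ transpose-conjugate {α = α} α-involutive x y))
      (Split.numOrbits-∘transpose (IsPermutation-∘ P Pα) αx≢αy αx⇝αy)
    merge : ∀ n → numOrbits σ ≡ n → numOrbits σ + numOrbits (σ ∘ α) ≤ numOrbits α + 2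
    merge zero V≡0 = ⊥-elim (1+n≢0 (trans (sym V-merge) V≡0))
    merge (suc n) V≡1+n = begin
      numOrbits σ + numOrbits (σ ∘ α)          ≡⟨ cong (_+ numOrbits (σ ∘ α)) V-merge ⟩
      suc (numOrbits σ′) + numOrbits (σ ∘ α)   ≡⟨ +-suc (numOrbits σ′) _ ⟨
      numOrbits σ′ + suc (numOrbits (σ ∘ α))   ≡⟨ cong (numOrbits σ′ +_) F-split ⟨
      numOrbits σ′ + numOrbits (σ′ ∘ α)        ≤⟨ euler-inequality′ n (∘transpose-IsPermutation x y P)
                                                    (suc-injective (trans (sym V-merge) V≡1+n))
                                                    (λ d e → Reach-∘transpose P (Merge.a⇝b P x⇝̸y) (connected d e)) ⟩
      numOrbits α + 2                          ∎
      where open ≤-Reasoning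
  ... | no none = begin
    numOrbits σ + numOrbits (σ ∘ α)                  ≤⟨ +-monoʳ-≤ (numOrbits σ)
                                                         (FixedPointFreeInvolution.numOrbits-∘α-≤ α-involutive α-nofix P) ⟩
    numOrbits σ + (numOrbits σ + numOrbits α)        ≡⟨ cong (λ V → V + (V + numOrbits α)) V≡1 ⟩
    2 + numOrbits α                                  ≡⟨ +-comm 2 (numOrbits α) ⟩
    numOrbits α + 2                                  ∎
    where
    open ≤-Reasoning
    V≡1 : numOrbits σ ≡ 1
    V≡1 = α-closed⇒one-vertex P connected λ x → decidable-stable (InOrbit? P x (α (σ x))) (λ x⇝̸y → none (x , x⇝̸y))

  euler-inequality : ∀ {σ : Fin k → Fin k} → IsPermutation σ → Connected σ α →
    numOrbits σ + numOrbits (σ ∘ α) ≤ numOrbits α + 2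
  euler-inequality P = euler-inequality′ _ P refl

-- Darts of the double cover are pairs (d , sheet), encoded in Fin (k + k).
module DoubleCover (k : ℕ) where

  enc : Fin k → Bool → Fin (k + k)
  enc d false = d ↑ˡ k
  enc d true  = k ↑ʳ d

  dec : Fin (k + k) → Fin k × Bool
  dec x with splitAt k x
  ... | inj₁ d = d , false
  ... | inj₂ d = d , true

  dec-enc : ∀ d b → dec (enc d b) ≡ (d , b)
  dec-enc d false rewrite splitAt-↑ˡ k d k = refl
  dec-enc d true  rewrite splitAt-↑ʳ k k d = refl

  enc-dec : ∀ x → enc (proj₁ (dec x)) (proj₂ (dec x)) ≡ x
  enc-dec x with splitAt k x in eq
  ... | inj₁ d = trans (cong (Fin.join k k) (sym eq)) (join-splitAt k k x)
  ... | inj₂ d = trans (cong (Fin.join k k) (sym eq)) (join-splitAt k k x)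

  enc-injective : ∀ {d e b c} → enc d b ≡ enc e c → d ≡ e × b ≡ c
  enc-injective {d} {e} {b} {c} eq =
    let same = trans (sym (dec-enc d b)) (trans (cong dec eq) (dec-enc e c)) in
    cong proj₁ same , cong proj₂ same

  enc-elim : (Q : Fin (k + k) → Set) → (∀ d b → Q (enc d b)) → ∀ x → Q x
  enc-elim Q h x = subst Q (enc-dec x) (h (proj₁ (dec x)) (proj₂ (dec x)))

  offset : Bool → ℕ
  offset false = 0
  offset true  = k

  toℕ-enc : ∀ d b → toℕ (enc d b) ≡ offset b + toℕ d
  toℕ-enc d false = toℕ-↑ˡ d k
  toℕ-enc d true  = toℕ-↑ʳ k d

  lift : (Fin k → Fin k) → (Fin k → Bool) → Fin (k + k) → Fin (k + k)
  lift g twist x = enc (g (proj₁ (dec x))) (twist (proj₁ (dec x)) xor proj₂ (dec x))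

  lift-enc : ∀ g twist d b → lift g twist (enc d b) ≡ enc (g d) (twist d xor b)
  lift-enc g twist d b rewrite dec-enc d b = refl

  lift-nofix : ∀ {g} twist → (∀ d → g d ≢ d) → ∀ x → lift g twist x ≢ x
  lift-nofix {g} twist g-nofix = enc-elim _ λ d b eq →
    g-nofix d (proj₁ (enc-injective {b = twist d xor b} {c = b} (trans (sym (lift-enc g twist d b)) eq)))

  untwisted : (Fin k → Fin k) → Fin (k + k) → Fin (k + k)
  untwisted g = lift g (λ _ → false)

  untwisted-enc : ∀ g d b → untwisted g (enc d b) ≡ enc (g d) b
  untwisted-enc g = lift-enc g (λ _ → false)

  module Untwisted {g : Fin k → Fin k} (P : IsPermutation g) where

    g̃ : Fin (k + k) → Fin (k + k)
    g̃ = untwisted g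

    g̃-IsPermutation : IsPermutation g̃
    g̃-IsPermutation = record
      { inv      = untwisted (inv P)
      ; inverseʳ = enc-elim _ λ d b → trans (cong g̃ (untwisted-enc (inv P) d b))
          (trans (untwisted-enc g _ b) (cong (λ z → enc z b) (inverseʳ P d)))
      ; inverseˡ = enc-elim _ λ d b → trans (cong (untwisted (inv P)) (untwisted-enc g d b))
          (trans (untwisted-enc (inv P) _ b) (cong (λ z → enc z b) (inverseˡ P d))) }

    iter-g̃ : ∀ j d b → iter g̃ j (enc d b) ≡ enc (iter g j d) b
    iter-g̃ zero    d b = refl
    iter-g̃ (suc j) d b = trans (cong g̃ (iter-g̃ j d b)) (untwisted-enc g (iter g j d) b)

    toℕ-iter-g̃ : ∀ j d b → toℕ (iter g̃ j (enc d b)) ≡ offset b + toℕ (iter g j d)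
    toℕ-iter-g̃ j d b = trans (cong toℕ (iter-g̃ j d b)) (toℕ-enc _ b)

    isOrbitMin-g̃ : ∀ d b → isOrbitMin g̃ (enc d b) ≡ isOrbitMin g d
    isOrbitMin-g̃ d b = ⇔→≡ {z = true} (mk⇔
      (λ min → isOrbitMin⇐ P d λ { (j , refl) → +-cancelˡ-≤ (offset b) _ _
         (subst₂ _≤_ (toℕ-iter-g̃ 0 d b) (toℕ-iter-g̃ j d b) (isOrbitMin⇒ g̃-IsPermutation _ min (j , refl))) })
      (λ min → isOrbitMin⇐ g̃-IsPermutation (enc d b) λ { (j , refl) →
         subst₂ _≤_ (sym (toℕ-iter-g̃ 0 d b)) (sym (toℕ-iter-g̃ j d b))
           (+-monoʳ-≤ (offset b) (isOrbitMin⇒ P d min (j , refl))) }))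

    numOrbits-g̃ : numOrbits g̃ ≡ 2 * numOrbits g
    numOrbits-g̃ = begin
      numOrbits g̃                                  ≡⟨ countᵇ-allFin (isOrbitMin g̃) ⟩
      sum (indicator ∘ isOrbitMin g̃)               ≡⟨ sum-split k k _ ⟩
      sum (λ d → indicator (isOrbitMin g̃ (enc d false))) + sum (λ d → indicator (isOrbitMin g̃ (enc d true)))
        ≡⟨ cong₂ _+_ (sum-cong-≗ {k} (cong indicator ∘ λ d → isOrbitMin-g̃ d false))
                     (sum-cong-≗ {k} (cong indicator ∘ λ d → isOrbitMin-g̃ d true)) ⟩
      minima + minima                              ≡⟨ cong (minima +_) (+-identityʳ _) ⟨
      2 * minima                                   ≡⟨ cong (2 *_) (countᵇ-allFin (isOrbitMin g)) ⟨
      2 * numOrbits g                              ∎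
      where
      open ≡-Reasoning
      minima : ℕ
      minima = sum (indicator ∘ isOrbitMin g)

Reach-sym : ∀ {k} {σ α : Fin k → Fin k} → (∀ d → σ (σ (σ d)) ≡ d) → (∀ d → α (α d) ≡ d) →
  ∀ {d e} → Reach σ α d e → Reach σ α e d
Reach-sym σ-cube α-involutive here = here
Reach-sym {σ = σ} {α} σ-cube α-involutive (stepσ {e = e} r) =
  Reach-trans (subst (Reach σ α (σ e)) (σ-cube e) (stepσ (stepσ here))) (Reach-sym σ-cube α-involutive r)
Reach-sym {σ = σ} {α} σ-cube α-involutive (stepα {e = e} r) =
  Reach-trans (subst (Reach σ α (α e)) (α-involutive e) (stepα here)) (Reach-sym σ-cube α-involutive r)

xor-cancelˡ : ∀ a b → a xor (a xor b) ≡ b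
xor-cancelˡ a b = trans (sym (xor-assoc a a b)) (cong (_xor b) (xor-same a))

xor-even-cancel : ∀ x y z b → x xor y xor z ≡ false → z xor (y xor (x xor b)) ≡ b
xor-even-cancel false false false b _ = refl
xor-even-cancel true  true  false b _ = not-involutive b
xor-even-cancel true  false true  b _ = not-involutive b
xor-even-cancel false true  true  b _ = not-involutive b

-- The counts of a planar cubic map and of a double cover in which vertices, edges and faces
-- all lift twice: the cover would have V′ + F′ = 2 (E + 2) = E′ + 4.
¬connected-double-cover : ∀ {k V E F V′ E′ F′} →
  3 * V ≡ k → 2 * E ≡ k → 3 * V′ ≡ k + k → 2 * E′ ≡ k + k → F′ ≡ 2 * F →
  V + F ≡ E + 2 → V′ + F′ ≤ E′ + 2 → ⊥
¬connected-double-cover {k} {V} {E} {F} {V′} {E′} {F′} 3V≡k 2E≡k 3V′≡2k 2E′≡2k F′≡2F euler euler′ =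
  4≰2 (+-cancelˡ-≤ E′ 4 2 (subst (_≤ E′ + 2) V′+F′≡E′+4 euler′))
  where
  V′≡V+V : V′ ≡ V + V
  V′≡V+V = *-cancelˡ-≡ V′ (V + V) 3
    (trans 3V′≡2k (trans (cong₂ _+_ (sym 3V≡k) (sym 3V≡k)) (sym (*-distribˡ-+ 3 V V))))
  E′≡E+E : E′ ≡ E + E
  E′≡E+E = *-cancelˡ-≡ E′ (E + E) 2
    (trans 2E′≡2k (trans (cong₂ _+_ (sym 2E≡k) (sym 2E≡k)) (sym (*-distribˡ-+ 2 E E))))
  double-sum : ∀ V F → (V + V) + 2 * F ≡ 2 * (V + F)
  double-sum = solve-∀
  double-euler : ∀ E → 2 * (E + 2) ≡ (E + E) + 4
  double-euler = solve-∀
  V′+F′≡E′+4 : V′ + F′ ≡ E′ + 4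
  V′+F′≡E′+4 = begin
    V′ + F′           ≡⟨ cong₂ _+_ V′≡V+V F′≡2F ⟩
    (V + V) + 2 * F   ≡⟨ double-sum V F ⟩
    2 * (V + F)       ≡⟨ cong (2 *_) euler ⟩
    2 * (E + 2)       ≡⟨ double-euler E ⟩
    (E + E) + 4       ≡⟨ cong (_+ 4) E′≡E+E ⟨
    E′ + 4            ∎
    where open ≡-Reasoning
  4≰2 : ¬ 4 ≤ 2
  4≰2 (s≤s (s≤s ()))

-- The colour of a dart is the sheet of the double cover reached over it from the root; it is
-- well defined because the cover is disconnected.
module FaceColouring {k : ℕ} (M : RootedCubicPlanarMap k) (twist : Fin k → Bool)
  (twist-α : ∀ d → twist (α M d) ≡ twist d)
  (twist-even : ∀ d → twist d xor twist (σ M d) xor twist (σ M (σ M d)) ≡ false) where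

  open DoubleCover k

  σ̃ α̃ : Fin (k + k) → Fin (k + k)
  σ̃ = lift (σ M) twist
  α̃ = lift (α M) twist

  σ̃-enc : ∀ d b → σ̃ (enc d b) ≡ enc (σ M d) (twist d xor b)
  σ̃-enc = lift-enc (σ M) twist

  α̃-enc : ∀ d b → α̃ (enc d b) ≡ enc (α M d) (twist d xor b)
  α̃-enc = lift-enc (α M) twist

  σ̃-cube-enc : ∀ d b → σ̃ (σ̃ (σ̃ (enc d b))) ≡ enc d b
  σ̃-cube-enc d b = begin
    σ̃ (σ̃ (σ̃ (enc d b)))                    ≡⟨ cong (σ̃ ∘ σ̃) (σ̃-enc d b) ⟩
    σ̃ (σ̃ (enc (σ M d) b₁))                 ≡⟨ cong σ̃ (σ̃-enc (σ M d) b₁) ⟩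
    σ̃ (enc (σ M (σ M d)) b₂)               ≡⟨ σ̃-enc (σ M (σ M d)) b₂ ⟩
    enc (σ M (σ M (σ M d))) (twist (σ M (σ M d)) xor b₂)
      ≡⟨ cong₂ enc (σ-cube M d) (xor-even-cancel (twist d) (twist (σ M d)) _ b (twist-even d)) ⟩
    enc d b                                ∎
    where
    open ≡-Reasoning
    b₁ b₂ : Bool
    b₁ = twist d xor b
    b₂ = twist (σ M d) xor b₁

  σ̃-cube : ∀ x → σ̃ (σ̃ (σ̃ x)) ≡ x
  σ̃-cube = enc-elim _ σ̃-cube-enc

  σ̃-nofix : ∀ x → σ̃ x ≢ x
  σ̃-nofix = lift-nofix twist (σ-nofix M)

  twist-across : ∀ d b → twist (α M d) xor (twist d xor b) ≡ b
  twist-across d b = trans (cong (_xor (twist d xor b)) (twist-α d)) (xor-cancelˡ (twist d) b)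

  α̃-involutive : ∀ x → α̃ (α̃ x) ≡ x
  α̃-involutive = enc-elim _ λ d b → trans (cong α̃ (α̃-enc d b))
    (trans (α̃-enc (α M d) (twist d xor b)) (cong₂ enc (α-invol M d) (twist-across d b)))

  α̃-nofix : ∀ x → α̃ x ≢ x
  α̃-nofix = lift-nofix twist (α-nofix M)

  φ̃-enc : ∀ d b → σ̃ (α̃ (enc d b)) ≡ enc (φ M d) b
  φ̃-enc d b = trans (cong σ̃ (α̃-enc d b))
    (trans (σ̃-enc (α M d) (twist d xor b)) (cong (enc (φ M d)) (twist-across d b)))

  cover-disconnected : ¬ Connected σ̃ α̃
  cover-disconnected connected̃ = ¬connected-double-cover {k}
    {numOrbits (σ M)} {numOrbits (α M)} {numOrbits (φ M)} {numOrbits σ̃} {numOrbits α̃} {numOrbits (σ̃ ∘ α̃)}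
    (FixedPointFreeOrder3.thrice-numOrbits {σ = σ M} (σ-cube M) (σ-nofix M))
    (FixedPointFreeInvolution.twice-numOrbits (α-invol M) (α-nofix M))
    (FixedPointFreeOrder3.thrice-numOrbits {σ = σ̃} σ̃-cube σ̃-nofix)
    (FixedPointFreeInvolution.twice-numOrbits α̃-involutive α̃-nofix)
    faces
    (euler M)
    (euler-inequality α̃-involutive α̃-nofix (enc (root M) false) (order3⇒IsPermutation {f = σ̃} σ̃-cube) connected̃)
    where
    Pφ : IsPermutation (φ M)
    Pφ = IsPermutation-∘ (order3⇒IsPermutation {f = σ M} (σ-cube M)) (involution⇒IsPermutation (α-invol M))
    faces : numOrbits (σ̃ ∘ α̃) ≡ 2 * numOrbits (φ M)
    faces = trans (numOrbits-cong (enc-elim _ λ d b → trans (φ̃-enc d b) (sym (untwisted-enc (φ M) d b))))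
                  (Untwisted.numOrbits-g̃ Pφ)

  sheet : ∀ {x d} → Reach (σ M) (α M) x d → Bool → Bool
  sheet here b = b
  sheet (stepσ {e = e} r) b = twist e xor sheet r b
  sheet (stepα {e = e} r) b = twist e xor sheet r b

  sheet-not : ∀ {x d} (r : Reach (σ M) (α M) x d) b → sheet r (not b) ≡ not (sheet r b)
  sheet-not here b = refl
  sheet-not (stepσ {e = e} r) b = trans (cong (twist e xor_) (sheet-not r b)) (sym (not-distribʳ-xor (twist e) _))
  sheet-not (stepα {e = e} r) b = trans (cong (twist e xor_) (sheet-not r b)) (sym (not-distribʳ-xor (twist e) _))

  Reach-lift : ∀ {x d} (r : Reach (σ M) (α M) x d) b → Reach σ̃ α̃ (enc x b) (enc d (sheet r b))
  Reach-lift here b = here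
  Reach-lift (stepσ {e = e} r) b = subst (Reach σ̃ α̃ _) (σ̃-enc e _) (stepσ (Reach-lift r b))
  Reach-lift (stepα {e = e} r) b = subst (Reach σ̃ α̃ _) (α̃-enc e _) (stepα (Reach-lift r b))

  r̃ : Fin (k + k)
  r̃ = enc (root M) false

  colour : Fin k → Bool
  colour d = sheet (connected M (root M) d) false

  Reach-colour : ∀ d → Reach σ̃ α̃ r̃ (enc d (colour d))
  Reach-colour d = Reach-lift (connected M (root M) d) false

  Reach-other-colour : ∀ d → Reach σ̃ α̃ (enc (root M) true) (enc d (not (colour d)))
  Reach-other-colour d = subst (Reach σ̃ α̃ _ ∘ enc d) (sheet-not (connected M (root M) d) false)
    (Reach-lift (connected M (root M) d) true)

  both-sheets⇒connected : ∀ {w} → Reach σ̃ α̃ r̃ (enc w (not (colour w))) → Connected σ̃ α̃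
  both-sheets⇒connected {w} r̃⇝other x y = Reach-trans (Reach-sym σ̃-cube α̃-involutive (from-r̃ x)) (from-r̃ y)
    where
    r̃⇝root-true : Reach σ̃ α̃ r̃ (enc (root M) true)
    r̃⇝root-true = Reach-trans r̃⇝other (Reach-sym σ̃-cube α̃-involutive (Reach-other-colour w))
    from-r̃ : ∀ x → Reach σ̃ α̃ r̃ x
    from-r̃ = enc-elim _ λ d b → case d b
      where
      case : ∀ d b → Reach σ̃ α̃ r̃ (enc d b)
      case d b with b Bool.≟ colour d
      ... | yes refl = Reach-colour d
      ... | no b≢c   = subst (Reach σ̃ α̃ r̃ ∘ enc d) (sym (¬-not b≢c))
                         (Reach-trans r̃⇝root-true (Reach-other-colour d))

  sheet-unique : ∀ {d b} → Reach σ̃ α̃ r̃ (enc d b) → b ≡ colour d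
  sheet-unique {d} {b} r̃⇝db with b Bool.≟ colour d
  ... | yes b≡c = b≡c
  ... | no b≢c  = ⊥-elim (cover-disconnected
                    (both-sheets⇒connected (subst (Reach σ̃ α̃ r̃ ∘ enc d) (¬-not b≢c) r̃⇝db)))

  colour-φ : ∀ d → colour (φ M d) ≡ colour d
  colour-φ d = sym (sheet-unique (Reach-trans (Reach-colour d)
    (subst (Reach σ̃ α̃ _) (φ̃-enc d (colour d)) (stepσ (stepα here)))))

  colour-α : ∀ d → colour (α M d) ≡ twist d xor colour d
  colour-α d = sym (sheet-unique (Reach-trans (Reach-colour d)
    (subst (Reach σ̃ α̃ _) (α̃-enc d (colour d)) (stepα here))))

toColour : Bool → Colour
toColour false = c1
toColour true  = c2

sameColour-sym : ∀ x y → sameColour x y ≡ sameColour y x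
sameColour-sym c1 c1 = refl
sameColour-sym c1 c2 = refl
sameColour-sym c2 c1 = refl
sameColour-sym c2 c2 = refl

sameColour-injective : ∀ a {b b′} → sameColour a b ≡ sameColour a b′ → b ≡ b′
sameColour-injective c1 {c1} {c1} _ = refl
sameColour-injective c1 {c2} {c2} _ = refl
sameColour-injective c2 {c1} {c1} _ = refl
sameColour-injective c2 {c2} {c2} _ = refl

sameColour-toColour-xor : ∀ r x t → sameColour (toColour (r xor x)) (toColour (r xor (t xor x))) ≡ not t
sameColour-toColour-xor true  true  true  = refl
sameColour-toColour-xor true  true  false = refl
sameColour-toColour-xor true  false true  = refl
sameColour-toColour-xor true  false false = refl
sameColour-toColour-xor false true  true  = refl
sameColour-toColour-xor false true  false = refl
sameColour-toColour-xor false false true  = refl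
sameColour-toColour-xor false false false = refl

triangle-monochromatic-edge : ∀ x y z →
  1 ≤ indicator (sameColour x y) + indicator (sameColour y z) + indicator (sameColour z x)
triangle-monochromatic-edge c1 c1 z  = s≤s z≤n
triangle-monochromatic-edge c2 c2 z  = s≤s z≤n
triangle-monochromatic-edge c1 c2 c1 = s≤s z≤n
triangle-monochromatic-edge c1 c2 c2 = s≤s z≤n
triangle-monochromatic-edge c2 c1 c1 = s≤s z≤n
triangle-monochromatic-edge c2 c1 c2 = s≤s z≤n

one-of-three⇒even-complement : ∀ x y z → indicator x + indicator y + indicator z ≡ 1 →
  not x xor not y xor not z ≡ false
one-of-three⇒even-complement true  false false _ = refl
one-of-three⇒even-complement false true  false _ = refl
one-of-three⇒even-complement false false true  _ = refl

module Correspondence {k n : ℕ} (M : RootedCubicPlanarMap k) (V≡2n : numVertices M ≡ 2 * n) where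

  private
    module Vertices = FixedPointFreeOrder3 (σ-cube M) (σ-nofix M)
    module Edges = FixedPointFreeInvolution (α-invol M) (α-nofix M)

  ConstantOnFaces : (Fin k → Colour) → Set
  ConstantOnFaces c = ∀ d → c (φ M d) ≡ c d

  monochromatic : (Fin k → Colour) → Fin k → Bool
  monochromatic c d = sameColour (c d) (c (α M d))

  edgesIn : (Fin k → Bool) → ℕ
  edgesIn m = countᵇ (λ d → isOrbitMin (α M) d ∧ m d) (allFin k)

  6n≡k : 3 * (2 * n) ≡ k
  6n≡k = trans (cong (3 *_) (sym V≡2n)) Vertices.thrice-numOrbits

  dartsIn≡2*edgesIn : ∀ m → (∀ d → m (α M d) ≡ m d) → countᵇ m (allFin k) ≡ 2 * edgesIn m
  dartsIn≡2*edgesIn m m-α = sym (Edges.twice-orbitMinima m m-α)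

  perfectMatching-size : ∀ {m} → IsPerfectMatching M m → edgesIn m ≡ n
  perfectMatching-size {m} (m-α , one-per-vertex) =
    *-cancelˡ-≡ _ n 2 (*-cancelˡ-≡ _ _ 3 (begin
      3 * (2 * edgesIn m)      ≡⟨ cong (3 *_) (dartsIn≡2*edgesIn m m-α) ⟨
      3 * countᵇ m (allFin k)  ≡⟨ Vertices.thrice-count m (λ d → trans (sym (countᵇ-triple m _ _ _)) (one-per-vertex d)) ⟩
      k                        ≡⟨ 6n≡k ⟨
      3 * (2 * n)              ∎))
    where open ≡-Reasoning

  colour-σ≡colour-α : ∀ {c} → ConstantOnFaces c → ∀ e → c (σ M e) ≡ c (α M e)
  colour-σ≡colour-α {c} c-φ e = trans (cong (c ∘ σ M) (sym (α-invol M e))) (c-φ (α M e))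

  colouring-unique : ∀ {c c′} → ConstantOnFaces c → ConstantOnFaces c′ → c (root M) ≡ c′ (root M) →
    (∀ d → monochromatic c d ≡ monochromatic c′ d) → ∀ d → c d ≡ c′ d
  colouring-unique {c} {c′} c-φ c′-φ same-root same-mono d = along (connected M (root M) d)
    where
    across : ∀ {e} → c e ≡ c′ e → c (α M e) ≡ c′ (α M e)
    across {e} c≡c′ = sameColour-injective (c e) (trans (same-mono e) (cong (λ x → sameColour x _) (sym c≡c′)))
    along : ∀ {e} → Reach (σ M) (α M) (root M) e → c e ≡ c′ e
    along here      = same-root
    along (stepα r) = across (along r)
    along (stepσ {e = e} r) =
      trans (colour-σ≡colour-α c-φ e) (trans (across (along r)) (sym (colour-σ≡colour-α c′-φ e)))

  module FromMatching (m : Fin k → Bool) (matching : IsPerfectMatching M m) where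

    open FaceColouring M (not ∘ m) (cong not ∘ proj₁ matching)
      (λ d → one-of-three⇒even-complement (m d) (m (σ M d)) (m (σ M (σ M d)))
               (trans (sym (countᵇ-triple m _ _ _)) (proj₂ matching d)))

    faceColouring : Fin k → Colour
    faceColouring d = toColour (colour (root M) xor colour d)

    faceColouring-φ : ConstantOnFaces faceColouring
    faceColouring-φ d = cong (toColour ∘ (colour (root M) xor_)) (colour-φ d)

    faceColouring-root : faceColouring (root M) ≡ c1
    faceColouring-root = cong toColour (xor-same (colour (root M)))

    monochromatic≡m : ∀ d → monochromatic faceColouring d ≡ m d
    monochromatic≡m d = begin
      sameColour (faceColouring d) (toColour (colour (root M) xor colour (α M d)))
        ≡⟨ cong (sameColour (faceColouring d) ∘ toColour ∘ (colour (root M) xor_)) (colour-α d) ⟩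
      sameColour (faceColouring d) (toColour (colour (root M) xor (not (m d) xor colour d)))
        ≡⟨ sameColour-toColour-xor (colour (root M)) (colour d) (not (m d)) ⟩
      not (not (m d))
        ≡⟨ not-involutive (m d) ⟩
      m d ∎
      where open ≡-Reasoning

    good : IsGoodColouring M n faceColouring
    good = faceColouring-φ , faceColouring-root ,
      trans (countᵇ-cong (λ d → cong (isOrbitMin (α M) d ∧_) (monochromatic≡m d)) (allFin k))
            (perfectMatching-size matching)

  module FromColouring (c : Fin k → Colour) (good : IsGoodColouring M n c) where

    m : Fin k → Bool
    m = monochromatic c

    m-α : ∀ d → m (α M d) ≡ m d
    m-α d = trans (cong (sameColour (c (α M d)) ∘ c) (α-invol M d)) (sameColour-sym (c (α M d)) (c d))

    m-σ : ∀ d → m d ≡ sameColour (c d) (c (σ M d))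
    m-σ d = cong (sameColour (c d)) (sym (colour-σ≡colour-α (proj₁ good) d))

    atVertex : Fin k → ℕ
    atVertex d = indicator (m d) + indicator (m (σ M d)) + indicator (m (σ M (σ M d)))

    atVertex-positive : ∀ d → 1 ≤ atVertex d
    atVertex-positive d rewrite m-σ d | m-σ (σ M d) | m-σ (σ M (σ M d)) | σ-cube M d =
      triangle-monochromatic-edge (c d) (c (σ M d)) (c (σ M (σ M d)))

    sum-atVertex : sum atVertex ≡ k
    sum-atVertex = begin
      sum atVertex                    ≡⟨ Vertices.sum-triples (indicator ∘ m) ⟩
      3 * sum (indicator ∘ m)         ≡⟨ cong (3 *_) (countᵇ-allFin m) ⟨
      3 * countᵇ m (allFin k)         ≡⟨ cong (3 *_) (dartsIn≡2*edgesIn m m-α) ⟩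
      3 * (2 * edgesIn m)             ≡⟨ cong (λ e → 3 * (2 * e)) (proj₂ (proj₂ good)) ⟩
      3 * (2 * n)                     ≡⟨ 6n≡k ⟩
      k                               ∎
      where open ≡-Reasoning

    matching : IsPerfectMatching M m
    matching = m-α , λ d → trans (countᵇ-triple m _ _ _) (sum≡n⇒all≡1 atVertex atVertex-positive sum-atVertex d)

  Matching Colouring : Set
  Matching  = Σ (Fin k → Bool) (IsPerfectMatching M)
  Colouring = Σ (Fin k → Colour) (IsGoodColouring M n)

  colouringOf : Matching → Colouring
  colouringOf (m , matching) = FromMatching.faceColouring m matching , FromMatching.good m matching

  monochromatic-colouringOf : ∀ (x : Matching) d → monochromatic (proj₁ (colouringOf x)) d ≡ proj₁ x d
  monochromatic-colouringOf (m , matching) = FromMatching.monochromatic≡m m matching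

  colouringOf-unique : ∀ (x : Matching) (y : Colouring) → (∀ d → monochromatic (proj₁ y) d ≡ proj₁ x d) →
    ∀ d → proj₁ (colouringOf x) d ≡ proj₁ y d
  colouringOf-unique (m , matching) (c , c-φ , c-root , _) mono≡m =
    colouring-unique (FromMatching.faceColouring-φ m matching) c-φ
      (trans (FromMatching.faceColouring-root m matching) (sym c-root))
      (λ d → trans (FromMatching.monochromatic≡m m matching d) (sym (mono≡m d)))

  colouringOf-cong : ∀ {x y : Matching} → (∀ d → proj₁ x d ≡ proj₁ y d) →
    ∀ d → proj₁ (colouringOf x) d ≡ proj₁ (colouringOf y) d
  colouringOf-cong {x} {y} x≈y =
    colouringOf-unique x (colouringOf y) (λ d → trans (monochromatic-colouringOf y d) (sym (x≈y d)))

  colouringOf-injective : ∀ {x y : Matching} → (∀ d → proj₁ (colouringOf x) d ≡ proj₁ (colouringOf y) d) →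
    ∀ d → proj₁ x d ≡ proj₁ y d
  colouringOf-injective {x} {y} same d = begin
    proj₁ x d                                     ≡⟨ monochromatic-colouringOf x d ⟨
    monochromatic (proj₁ (colouringOf x)) d       ≡⟨ cong₂ sameColour (same d) (same (α M d)) ⟩
    monochromatic (proj₁ (colouringOf y)) d       ≡⟨ monochromatic-colouringOf y d ⟩
    proj₁ y d                                     ∎
    where open ≡-Reasoning

  colouringOf-surjective : ∀ (y : Colouring) → ∃ λ (x : Matching) →
    ∀ {z : Matching} → (∀ d → proj₁ z d ≡ proj₁ x d) → ∀ d → proj₁ (colouringOf z) d ≡ proj₁ y d
  colouringOf-surjective y@(c , good) =
    (FromColouring.m c good , FromColouring.matching c good) , λ {z} z≈x → colouringOf-unique z y (sym ∘ z≈x)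

  bijection : Bijection (PerfectMatchings M) (GoodColourings M n)
  bijection = record
    { to        = colouringOf
    ; cong      = λ {x} {y} → colouringOf-cong {x} {y}
    ; bijective = (λ {x} {y} → colouringOf-injective {x} {y}) , colouringOf-surjective }

lemma5 : (k n : ℕ) (M : RootedCubicPlanarMap k) → numVertices M ≡ 2 * n →
    Bijection (PerfectMatchings M) (GoodColourings M n)
lemma5 k n M V≡2n = Correspondence.bijection M V≡2n
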